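{- For every $n\ge 3$, $H_n(1)=p_{n-2}$, where $(p_m)$ is the sequence with $p_0=1$, $p_1=3$, $p_2=3$ and $p_m=p_{m-2}+p_{m-3}$ for $m\ge3$.
   Context: For $n\ge 0$, the $S$-fence $\phi_n$ is the poset on $\{x_1,\dots,x_n\}$ whose order is generated by the cover relations $x_2<x_1$, $x_3<x_2$, $x_2<x_4$, $x_5<x_4$, and, for every $i\ge 3$, $x_{2i-1}<x_{2i}$ and $x_{2i+1}<x_{2i}$, keeping only those relations whose elements both have index $\le n$. A filter is an up-set. $\Phi_n$ is the underlying undirected graph of the Hasse diagram of the lattice of filters of $\phi_n$ ordered by reverse inclusion (two filters adjacent iff they differ in exactly one element). A maximal $k$-dimensional cube of $\Phi_n$ is an induced subgraph isomorphic to the hypercube $Q_k$ not contained in any induced hypercube subgraph of larger dimension; $h_{n,k}$ is their number and $H_n(x)=\sum_{k\ge0}h_{n,k}x^k$. Thus $H_n(1)$ is the total number of maximal cubes of $\Phi_n$. -}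

module Defs where

open import Data.Nat using (ℕ; zero; suc; _+_; _*_; _<_)
open import Data.Fin using (Fin; toℕ)
open import Data.Fin.Subset using (Subset; _∈_)
open import Data.Vec using (lookup)
open import Data.Bool using (Bool; true)
open import Data.Product using (Σ; ∃; ∃-syntax; _×_)
open import Relation.Nullary using (¬_)
open import Relation.Binary.PropositionalEquality using (_≡_; _≢_)
open import Relation.Binary.Construct.Closure.ReflexiveTransitive using (Star)
open import Function.Bundles using (_⇔_)
open import Function.Definitions using (Injective)

-- Cover relations of the S-fence, on 1-based indices:
-- CoverIdx i j  means  x_i < x_j  is a generating cover relation.
data CoverIdx : ℕ → ℕ → Set where
  c21 : CoverIdx 2 1
  c32 : CoverIdx 3 2
  c24 : CoverIdx 2 4
  c54 : CoverIdx 5 4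
  -- for i = m + 3 ≥ 3 :  x_{2i-1} < x_{2i}  and  x_{2i+1} < x_{2i}
  cOdd  : ∀ m → CoverIdx (2 * m + 5) (2 * m + 6)
  cOdd' : ∀ m → CoverIdx (2 * m + 7) (2 * m + 6)

-- The elements of φ_n are Fin n, where  a : Fin n  stands for x_{toℕ a + 1}.
-- Only relations among elements with index ≤ n are kept (automatic).
Cover : (n : ℕ) → Fin n → Fin n → Set
Cover n a b = CoverIdx (suc (toℕ a)) (suc (toℕ b))

_≤φ_ : {n : ℕ} → Fin n → Fin n → Set
_≤φ_ {n} = Star (Cover n)

IsFilter : (n : ℕ) → Subset n → Set
IsFilter n U = ∀ (x y : Fin n) → x ≤φ y → x ∈ U → y ∈ U

Adj1 : {m : ℕ} → Subset m → Subset m → Set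
Adj1 {m} u v = ∃[ i ] (lookup u i ≢ lookup v i
                       × (∀ (j : Fin m) → j ≢ i → lookup u j ≡ lookup v j))

VSet : ℕ → Set
VSet n = Subset n → Bool

_∈V_ : {n : ℕ} → Subset n → VSet n → Set
U ∈V S = S U ≡ true

_⊆V_ : {n : ℕ} → VSet n → VSet n → Set
S ⊆V T = ∀ U → U ∈V S → U ∈V T

-- S induces in Φ_n a subgraph isomorphic to the hypercube Q_k
-- (vertices of Q_k: Subset k; adjacency: differ in one coordinate).
-- Vertices of Φ_n are filters; adjacency is Adj1.
IsCube : (n k : ℕ) → VSet n → Set
IsCube n k S =
  Σ (Subset k → Subset n) λ f →
      (∀ a → IsFilter n (f a))
    × (∀ a → f a ∈V S)
    × (∀ U → U ∈V S → ∃[ a ] f a ≡ U)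
    × Injective _≡_ _≡_ f
    × (∀ a b → Adj1 (f a) (f b) ⇔ Adj1 a b)

IsMaxCube : (n k : ℕ) → VSet n → Set
IsMaxCube n k S =
  IsCube n k S × ¬ (∃[ k' ] ∃[ T ] (k < k' × IsCube n k' T × S ⊆V T))

IsMaximalCube : (n : ℕ) → VSet n → Set
IsMaximalCube n S = ∃[ k ] IsMaxCube n k S

_≐_ : {n : ℕ} → VSet n → VSet n → Set
S ≐ T = ∀ U → S U ≡ T U

-- H_n(1) = c : the maximal cubes of Φ_n (as vertex sets) are enumerated
-- without repetition by Fin c.
HOneEq : (n c : ℕ) → Set
HOneEq n c =
  Σ (Fin c → VSet n) λ L →
      (∀ i → IsMaximalCube n (L i))
    × (∀ i j → L i ≐ L j → i ≡ j)
    × (∀ S → IsMaximalCube n S → ∃[ i ] S ≐ L i)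

p : ℕ → ℕ
p 0 = 1
p 1 = 3
p 2 = 3
p (suc (suc (suc m))) = p (suc m) + p m

-- A cube of Φ_n is the image of an affine map into the Boolean lattice of subsets (every hypercube
-- embedding into a Boolean cube is affine), so it is described by labelling each element of φ_n by
-- O (in no vertex), I (in every vertex) or C (free coordinate). Its vertices are all filters iff every
-- cover x ⋖ y has x labelled O or y labelled I, and the cube is maximal iff moreover no O- or I-element
-- can be freed. From x₄ on, φ_n is a zigzag, and reading a maximal labelling from the top shows that it
-- ends either in (natural, C) or in (natural, C, natural), where the natural label is O on minima and
-- I on maxima. So the maximal labellings of φ_n are those of φ_(n-2) and of φ_(n-3), extended, which is
-- the recursion p_(n-2) = p_(n-4) + p_(n-5) for n ≥ 8; the cases n ≤ 7 are checked exhaustively.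

module Submission where

open import Defs
open import Data.Bool using (Bool; true; false; not; _∧_; _∨_; _xor_; if_then_else_)
open import Data.Bool.Properties using (xor-same; xor-assoc; xor-identityʳ; xor-annihilates-not; not-distribˡ-xor; not-distribʳ-xor; ∧-zeroʳ; ∧-identityʳ; ∨-zeroʳ; not-involutive) renaming (_≟_ to _≟ᵇ_)
open import Data.Empty using (⊥-elim)
open import Data.Fin using (Fin; zero; suc; toℕ; fromℕ<; splitAt; join; _↑ˡ_; _↑ʳ_)
open import Data.Fin.Properties using (_≟_; all?; any?; suc-injective; 0≢1+n; toℕ<n; toℕ-fromℕ<; pigeonhole; <⇒≢; ¬∀⟶∃¬; splitAt-↑ˡ; splitAt-↑ʳ; join-splitAt)
open import Data.Fin.Subset using (Subset; ⊥; ⁅_⁆)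
open import Data.Nat as ℕ using (ℕ; _+_; _*_; _∸_; _≤_; _<_; z≤n; s≤s)
open import Data.Nat.Properties as ℕₚ using (≤-trans; ≤-refl; ≤-reflexive; n≤1+n; m≤n⇒m≤1+n; 1+n≰n; n<1+n; m≤n+m; +-suc; *-suc; +-cancelˡ-≡)
open import Data.Product using (Σ-syntax; ∃-syntax; _×_; _,_; proj₁; proj₂)
open import Data.Sum using (_⊎_; inj₁; inj₂; [_,_]′)
import Data.Sum as Sum
open import Data.Vec using (Vec; []; _∷_; lookup; tabulate; zipWith; head; tail)
open import Data.Vec.Properties using (lookup-replicate; lookup∘tabulate; tabulate∘lookup; tabulate-cong; lookup-zipWith; []=⇒lookup; lookup⇒[]=)
open import Data.Vec.Functional using () renaming (_∷_ to _∷ᶠ_)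
open import Function using (_∘_)
open import Function.Bundles using (_⇔_; mk⇔; Equivalence)
open import Function.Definitions using (Injective)
open import Relation.Binary.Construct.Closure.ReflexiveTransitive using (ε; _◅_)
open import Relation.Binary.PropositionalEquality
open import Relation.Nullary using (¬_; Dec; yes; no; does)
open import Relation.Nullary.Decidable using (dec-true; dec-false; dec-yes; does-⇔; from-yes; map′; ¬?; _×-dec_; _⊎-dec_; _→-dec_)

xor-cancelˡ : ∀ x y → x xor (x xor y) ≡ y
xor-cancelˡ false y = refl
xor-cancelˡ true y = not-involutive y

xor-cancelʳ : ∀ x y → (x xor y) xor y ≡ x
xor-cancelʳ x y = trans (xor-assoc x y y) (trans (cong (x xor_) (xor-same y)) (xor-identityʳ x))

xor-injectiveʳ : ∀ x {y z} → x xor y ≡ x xor z → y ≡ z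
xor-injectiveʳ x {y} {z} e = trans (sym (xor-cancelˡ x y)) (trans (cong (x xor_) e) (xor-cancelˡ x z))

xor-cancel-common : ∀ v x y → (v xor x) xor (v xor y) ≡ x xor y
xor-cancel-common false x y = refl
xor-cancel-common true x y = xor-annihilates-not x y

true≢false : true ≢ false
true≢false ()

lookup-extensionality : ∀ {a} {A : Set a} {n} {xs ys : Vec A n} → (∀ i → lookup xs i ≡ lookup ys i) → xs ≡ ys
lookup-extensionality {xs = xs} {ys} h = trans (sym (tabulate∘lookup xs)) (trans (tabulate-cong h) (tabulate∘lookup ys))

does-true⇒ : ∀ {p} {P : Set p} (p? : Dec P) → does p? ≡ true → P
does-true⇒ (yes p) _ = p
does-true⇒ (no _) ()

δ : ∀ {n} → Fin n → Fin n → Bool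
δ i j = does (i ≟ j)

δ-refl : ∀ {n} (i : Fin n) → δ i i ≡ true
δ-refl i = dec-true (i ≟ i) refl

δ-≢ : ∀ {n} {i j : Fin n} → i ≢ j → δ i j ≡ false
δ-≢ {i = i} {j} = dec-false (i ≟ j)

δ-true⇒≡ : ∀ {n} {i j : Fin n} → δ i j ≡ true → i ≡ j
δ-true⇒≡ {i = i} {j} = does-true⇒ (i ≟ j)

δ-injective : ∀ {k n} {c : Fin k → Fin n} → (∀ {i i′} → c i ≡ c i′ → i ≡ i′) → ∀ i i′ → δ (c i) (c i′) ≡ δ i i′
δ-injective {c = c} c-inj i i′ with i ≟ i′
... | yes refl = δ-refl (c i)
... | no i≢i′ = δ-≢ (i≢i′ ∘ c-inj)

lookup-⁅⁆ : ∀ {n} (i j : Fin n) → lookup ⁅ i ⁆ j ≡ δ i j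
lookup-⁅⁆ zero zero = refl
lookup-⁅⁆ zero (suc j) = lookup-replicate j false
lookup-⁅⁆ (suc i) zero = refl
lookup-⁅⁆ (suc i) (suc j) = lookup-⁅⁆ i j

⁅⁆-injective : ∀ {n} {i j : Fin n} → ⁅ i ⁆ ≡ ⁅ j ⁆ → i ≡ j
⁅⁆-injective {i = i} {j} e = δ-true⇒≡ (trans (sym (lookup-⁅⁆ i j)) (trans (cong (λ s → lookup s j) e) (trans (lookup-⁅⁆ j j) (δ-refl j))))

unit-sum-three : ∀ {n} {r d a b : Fin n} → (∀ j → δ r j ≡ (δ d j xor δ a j) xor δ b j) → d ≢ b → a ≢ d → a ≡ b
unit-sum-three {r = r} {d} {a} {b} sum d≢b a≢d with a ≟ b
... | yes a≡b = a≡b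
... | no a≢b = ⊥-elim (d≢b (trans (sym r≡d) r≡b))
  where
  r≡d : r ≡ d
  r≡d = δ-true⇒≡ (trans (sum d) (cong₂ _xor_ (cong₂ _xor_ (δ-refl d) (δ-≢ a≢d)) (δ-≢ (d≢b ∘ sym))))
  r≡b : r ≡ b
  r≡b = δ-true⇒≡ (trans (sum b) (cong₂ _xor_ (cong₂ _xor_ (δ-≢ d≢b) (δ-≢ a≢b)) (δ-refl b)))

-- Hypercube embeddings

DifferAt : ∀ {n} → Subset n → Subset n → Fin n → Set
DifferAt u v r = ∀ j → lookup u j xor lookup v j ≡ δ r j

Adj1⇒DifferAt : ∀ {n} (u v : Subset n) → Adj1 u v → ∃[ r ] DifferAt u v r
Adj1⇒DifferAt u v (r , u≢v , rest) = r , differ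
  where
  differ : DifferAt u v r
  differ j with r ≟ j
  ... | yes refl = xor-≢ u≢v
    where
    xor-≢ : ∀ {x y} → x ≢ y → x xor y ≡ true
    xor-≢ {false} {false} ne = ⊥-elim (ne refl)
    xor-≢ {false} {true} _ = refl
    xor-≢ {true} {false} _ = refl
    xor-≢ {true} {true} ne = ⊥-elim (ne refl)
  ... | no r≢j = trans (cong (_xor lookup v j) (rest j (r≢j ∘ sym))) (xor-same (lookup v j))

DifferAt⇒Adj1 : ∀ {n} (u v : Subset n) r → DifferAt u v r → Adj1 u v
DifferAt⇒Adj1 u v r differ = r , u≢v , agree
  where
  u≢v : lookup u r ≢ lookup v r
  u≢v e = true≢false (trans (sym (trans (differ r) (δ-refl r))) (trans (cong (_xor lookup v r) e) (xor-same (lookup v r))))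
  agree : ∀ j → j ≢ r → lookup u j ≡ lookup v j
  agree j j≢r = trans (sym (xor-cancelʳ (lookup u j) (lookup v j))) (cong (_xor lookup v j) (trans (differ j) (δ-≢ (j≢r ∘ sym))))

DifferAt-flip : ∀ {n} {u v : Subset n} {r} → DifferAt u v r → ∀ j → lookup v j ≡ lookup u j xor δ r j
DifferAt-flip {u = u} {v} differ j = trans (sym (xor-cancelˡ (lookup u j) (lookup v j))) (cong (lookup u j xor_) (differ j))

DifferAt-∷ : ∀ {n} (x : Bool) {a b : Subset n} {r} → DifferAt a b r → DifferAt (x ∷ a) (x ∷ b) (suc r)
DifferAt-∷ x differ zero = xor-same x
DifferAt-∷ x differ (suc j) = differ j

-- The image of a ⊆ Fin k under the linear map Q_k → Q_n sending e_i to e_(c i).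
linear : ∀ {k n} → (Fin k → Fin n) → Subset k → Fin n → Bool
linear c [] j = false
linear c (b ∷ a) j = (b ∧ δ (c zero) j) xor linear (c ∘ suc) a j

linear-cong : ∀ {k n} {c c′ : Fin k → Fin n} → (∀ i → c i ≡ c′ i) → ∀ a j → linear c a j ≡ linear c′ a j
linear-cong c≗c′ [] j = refl
linear-cong {c′ = c′} c≗c′ (b ∷ a) j rewrite c≗c′ zero = cong ((b ∧ δ (c′ zero) j) xor_) (linear-cong (c≗c′ ∘ suc) a j)

linear-⊥ : ∀ {k n} (c : Fin k → Fin n) j → linear c ⊥ j ≡ false
linear-⊥ {ℕ.zero} c j = refl
linear-⊥ {ℕ.suc k} c j = linear-⊥ (c ∘ suc) j

linear-⁅⁆ : ∀ {k n} (c : Fin k → Fin n) i j → linear c ⁅ i ⁆ j ≡ δ (c i) j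
linear-⁅⁆ c zero j rewrite linear-⊥ (c ∘ suc) j = xor-identityʳ (δ (c zero) j)
linear-⁅⁆ c (suc i) j = linear-⁅⁆ (c ∘ suc) i j

linear-outside : ∀ {k n} (c : Fin k → Fin n) j → (∀ i → c i ≢ j) → ∀ a → linear c a j ≡ false
linear-outside c j j∉c [] = refl
linear-outside c j j∉c (b ∷ a) rewrite δ-≢ (j∉c zero) | ∧-zeroʳ b = linear-outside (c ∘ suc) j (j∉c ∘ suc) a

linear-at : ∀ {k n} {c : Fin k → Fin n} → (∀ {i i′} → c i ≡ c i′ → i ≡ i′) → ∀ a i → linear c a (c i) ≡ lookup a i
linear-at {c = c} c-inj (b ∷ a) zero
  rewrite δ-refl (c zero) | linear-outside (c ∘ suc) (c zero) (λ i e → 0≢1+n (sym (c-inj e))) a =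
  trans (xor-identityʳ (b ∧ true)) (∧-identityʳ b)
linear-at {c = c} c-inj (b ∷ a) (suc i) rewrite δ-≢ {i = c zero} {c (suc i)} (0≢1+n ∘ c-inj) | ∧-zeroʳ b =
  linear-at (suc-injective ∘ c-inj) a i

linear-true⇒∈image : ∀ {k n} (c : Fin k → Fin n) a j → linear c a j ≡ true → ∃[ i ] c i ≡ j
linear-true⇒∈image c [] j ()
linear-true⇒∈image c (b ∷ a) j e with δ (c zero) j in c₀≡j
... | true = zero , δ-true⇒≡ c₀≡j
... | false rewrite ∧-zeroʳ b with linear-true⇒∈image (c ∘ suc) a j e
...   | i , cᵢ≡j = suc i , cᵢ≡j

linear-xor : ∀ {k n} (c : Fin k → Fin n) a b j → linear c a j xor linear c b j ≡ linear c (zipWith _xor_ a b) j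
linear-xor c [] [] j = refl
linear-xor c (x ∷ a) (y ∷ b) j =
  trans (interchange x y (δ (c zero) j) (linear (c ∘ suc) a j) (linear (c ∘ suc) b j))
        (cong (((x xor y) ∧ δ (c zero) j) xor_) (linear-xor (c ∘ suc) a b j))
  where
  interchange : ∀ x y e u v → ((x ∧ e) xor u) xor ((y ∧ e) xor v) ≡ ((x xor y) ∧ e) xor (u xor v)
  interchange x y false u v rewrite ∧-zeroʳ x | ∧-zeroʳ y | ∧-zeroʳ (x xor y) = refl
  interchange false false true u v = refl
  interchange false true true u v = sym (not-distribʳ-xor u v)
  interchange true false true u v = sym (not-distribˡ-xor u v)
  interchange true true true u v = xor-annihilates-not u v

IsAffine : ∀ {k n} → (Subset k → Subset n) → (Fin k → Fin n) → Set
IsAffine f c = ∀ a j → lookup (f a) j ≡ lookup (f ⊥) j xor linear c a j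

PreservesEdges : ∀ {k n} → (Subset k → Subset n) → Set
PreservesEdges f = ∀ a b r → DifferAt a b r → ∃[ s ] DifferAt (f a) (f b) s

-- In the square spanned by the first coordinate and coordinate i + 1, the rung f (1 ∷ eᵢ) — f (0 ∷ eᵢ)
-- forces both halves of the cube to move in the same direction along coordinate i.
halves-parallel : ∀ {k n} (f : Subset (ℕ.suc k) → Subset n) → Injective _≡_ _≡_ f → PreservesEdges f →
  ∀ {c₀ c₁ : Fin k → Fin n} {d} → IsAffine (f ∘ (false ∷_)) c₀ → IsAffine (f ∘ (true ∷_)) c₁ →
  (∀ j → lookup (f (true ∷ ⊥)) j ≡ lookup (f ⊥) j xor δ d j) → ∀ i → c₁ i ≡ c₀ i
halves-parallel f f-inj f-edge {c₀} {c₁} {d} affine₀ affine₁ f-e₀ i = unit-sum-three {r = r} square d≢c₀ c₁≢d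
  where
  u = f ⊥
  f₀-e : ∀ j → lookup (f (false ∷ ⁅ i ⁆)) j ≡ lookup u j xor δ (c₀ i) j
  f₀-e j = trans (affine₀ ⁅ i ⁆ j) (cong (lookup u j xor_) (linear-⁅⁆ c₀ i j))
  f₁-e : ∀ j → lookup (f (true ∷ ⁅ i ⁆)) j ≡ (lookup u j xor δ d j) xor δ (c₁ i) j
  f₁-e j = trans (affine₁ ⁅ i ⁆ j) (cong₂ _xor_ (f-e₀ j) (linear-⁅⁆ c₁ i j))
  d≢c₀ : d ≢ c₀ i
  d≢c₀ d≡c₀ = true≢false (cong head (f-inj (lookup-extensionality λ j →
    trans (f-e₀ j) (trans (cong (λ x → lookup u j xor δ x j) d≡c₀) (sym (f₀-e j))))))
  c₁≢d : c₁ i ≢ d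
  c₁≢d c₁≡d = true≢false (cong head (f-inj (lookup-extensionality λ j →
    trans (f₁-e j) (trans (cong (λ x → (lookup u j xor δ d j) xor δ x j) c₁≡d) (xor-cancelʳ (lookup u j) (δ d j))))))
  rung : DifferAt (true ∷ ⁅ i ⁆) (false ∷ ⁅ i ⁆) zero
  rung zero = refl
  rung (suc j) = xor-same (lookup ⁅ i ⁆ j)
  r : Fin _
  r = proj₁ (f-edge (true ∷ ⁅ i ⁆) (false ∷ ⁅ i ⁆) zero rung)
  square : ∀ j → δ r j ≡ (δ d j xor δ (c₁ i) j) xor δ (c₀ i) j
  square j = begin
    δ r j                                                              ≡⟨ sym (proj₂ (f-edge (true ∷ ⁅ i ⁆) (false ∷ ⁅ i ⁆) zero rung) j) ⟩
    lookup (f (true ∷ ⁅ i ⁆)) j xor lookup (f (false ∷ ⁅ i ⁆)) j      ≡⟨ cong₂ _xor_ (f₁-e j) (f₀-e j) ⟩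
    ((lookup u j xor δ d j) xor δ (c₁ i) j) xor (lookup u j xor δ (c₀ i) j)
      ≡⟨ cong (_xor (lookup u j xor δ (c₀ i) j)) (xor-assoc (lookup u j) (δ d j) (δ (c₁ i) j)) ⟩
    (lookup u j xor (δ d j xor δ (c₁ i) j)) xor (lookup u j xor δ (c₀ i) j)
      ≡⟨ xor-cancel-common (lookup u j) (δ d j xor δ (c₁ i) j) (δ (c₀ i) j) ⟩
    (δ d j xor δ (c₁ i) j) xor δ (c₀ i) j                              ∎
    where open ≡-Reasoning

cube-embedding-affine : ∀ k {n} (f : Subset k → Subset n) → Injective _≡_ _≡_ f → PreservesEdges f → ∃[ c ] IsAffine f c
cube-embedding-affine ℕ.zero f _ _ = (λ ()) , λ { [] j → sym (xor-identityʳ (lookup (f []) j)) }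
cube-embedding-affine (ℕ.suc k) {n} f f-inj f-edge = d ∷ᶠ c₀ , f-affine
  where
  affine₀ : ∃[ c₀ ] IsAffine (f ∘ (false ∷_)) c₀
  affine₀ = cube-embedding-affine k (f ∘ (false ∷_)) (λ {a} {b} e → cong tail (f-inj {false ∷ a} {false ∷ b} e))
                                   (λ a b r e → f-edge (false ∷ a) (false ∷ b) (suc r) (DifferAt-∷ false e))
  affine₁ : ∃[ c₁ ] IsAffine (f ∘ (true ∷_)) c₁
  affine₁ = cube-embedding-affine k (f ∘ (true ∷_)) (λ {a} {b} e → cong tail (f-inj {true ∷ a} {true ∷ b} e))
                                   (λ a b r e → f-edge (true ∷ a) (true ∷ b) (suc r) (DifferAt-∷ true e))
  c₀ = proj₁ affine₀
  c₁ = proj₁ affine₁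
  first-edge : DifferAt ⊥ (true ∷ ⊥) zero
  first-edge zero = refl
  first-edge (suc j) = xor-same (lookup ⊥ j)
  d : Fin n
  d = proj₁ (f-edge ⊥ (true ∷ ⊥) zero first-edge)
  f-e₀ : ∀ j → lookup (f (true ∷ ⊥)) j ≡ lookup (f ⊥) j xor δ d j
  f-e₀ = DifferAt-flip {u = f ⊥} {f (true ∷ ⊥)} {d} (proj₂ (f-edge ⊥ (true ∷ ⊥) zero first-edge))
  f-affine : IsAffine f (d ∷ᶠ c₀)
  f-affine (false ∷ a) j = proj₂ affine₀ a j
  f-affine (true ∷ a) j = begin
    lookup (f (true ∷ a)) j                                ≡⟨ proj₂ affine₁ a j ⟩
    lookup (f (true ∷ ⊥)) j xor linear c₁ a j              ≡⟨ cong₂ _xor_ (f-e₀ j) (linear-cong (halves-parallel f f-inj f-edge {d = d} (proj₂ affine₀) (proj₂ affine₁) f-e₀) a j) ⟩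
    (lookup (f ⊥) j xor δ d j) xor linear c₀ a j           ≡⟨ xor-assoc (lookup (f ⊥) j) (δ d j) (linear c₀ a j) ⟩
    lookup (f ⊥) j xor (δ d j xor linear c₀ a j)           ∎
    where open ≡-Reasoning

-- Cubes of Φ_n as labellings of φ_n

-- O: the element lies in no vertex of the cube, I: in every vertex, C: it is a free coordinate.
data Label : Set where
  O I C : Label

O≢I : O ≢ I
O≢I ()

O≢C : O ≢ C
O≢C ()

I≢C : I ≢ C
I≢C ()

fits : Label → Bool → Bool
fits O b = not b
fits I b = b
fits C b = true

Fits : ∀ {n} → (Fin n → Label) → Subset n → Set
Fits lab U = ∀ j → fits (lab j) (lookup U j) ≡ true

vertices : ∀ {n} → (Fin n → Label) → VSet n
vertices lab U = does (all? (λ j → fits (lab j) (lookup U j) ≟ᵇ true))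

Fits⇒∈vertices : ∀ {n} (lab : Fin n → Label) U → Fits lab U → U ∈V vertices lab
Fits⇒∈vertices lab U = dec-true (all? (λ j → fits (lab j) (lookup U j) ≟ᵇ true))

∈vertices⇒Fits : ∀ {n} (lab : Fin n → Label) U → U ∈V vertices lab → Fits lab U
∈vertices⇒Fits lab U = does-true⇒ (all? (λ j → fits (lab j) (lookup U j) ≟ᵇ true))

vertices-cong : ∀ {n} {lab lab′ : Fin n → Label} → (∀ j → lab j ≡ lab′ j) → vertices lab ≐ vertices lab′
vertices-cong {lab = lab} {lab′} lab≗lab′ U =
  does-⇔ (mk⇔ (λ h j → subst (λ l → fits l (lookup U j) ≡ true) (lab≗lab′ j) (h j))
               (λ h j → subst (λ l → fits l (lookup U j) ≡ true) (sym (lab≗lab′ j)) (h j)))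
         (all? (λ j → fits (lab j) (lookup U j) ≟ᵇ true)) (all? (λ j → fits (lab′ j) (lookup U j) ≟ᵇ true))

-- Every vertex of the cube is a filter.
Closed : ∀ {n} → (Fin n → Label) → Set
Closed {n} lab = ∀ x y → Cover n x y → lab x ≡ O ⊎ lab y ≡ I

-- No element labelled O or I can be turned into a free coordinate: this characterises maximality.
O-rigid : ∀ {n} → (Fin n → Label) → Set
O-rigid {n} lab = ∀ x → lab x ≡ O → ¬ ((∀ y → Cover n x y → lab y ≡ I) × (∀ y → Cover n y x → lab y ≡ O))

I-rigid : ∀ {n} → (Fin n → Label) → Set
I-rigid {n} lab = ∀ x → lab x ≡ I → ¬ (∀ y → Cover n y x → lab y ≡ O)

IsMaximalLabelling : ∀ {n} → (Fin n → Label) → Set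
IsMaximalLabelling lab = Closed lab × O-rigid lab × I-rigid lab

cover-closed⇒IsFilter : ∀ {n} (U : Subset n) → (∀ x y → Cover n x y → lookup U x ≡ true → lookup U y ≡ true) → IsFilter n U
cover-closed⇒IsFilter U closed x y ε x∈U = x∈U
cover-closed⇒IsFilter U closed x y (x⋖z ◅ z≤y) x∈U =
  cover-closed⇒IsFilter U closed _ y z≤y (lookup⇒[]= _ U (closed x _ x⋖z ([]=⇒lookup x∈U)))

Cover-irreflexive : ∀ {n} {x y : Fin n} → Cover n x y → x ≢ y
Cover-irreflexive x⋖y refl = CoverIdx-irreflexive x⋖y refl
  where
  CoverIdx-irreflexive : ∀ {i j} → CoverIdx i j → i ≢ j
  CoverIdx-irreflexive c21 ()
  CoverIdx-irreflexive c32 ()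
  CoverIdx-irreflexive c24 ()
  CoverIdx-irreflexive c54 ()
  CoverIdx-irreflexive (cOdd m) e with +-cancelˡ-≡ (2 * m) 5 6 e
  ... | ()
  CoverIdx-irreflexive (cOdd' m) e with +-cancelˡ-≡ (2 * m) 7 6 e
  ... | ()

_≟ᴸ_ : (l l′ : Label) → Dec (l ≡ l′)
O ≟ᴸ O = yes refl
O ≟ᴸ I = no (λ ())
O ≟ᴸ C = no (λ ())
I ≟ᴸ O = no (λ ())
I ≟ᴸ I = yes refl
I ≟ᴸ C = no (λ ())
C ≟ᴸ O = no (λ ())
C ≟ᴸ I = no (λ ())
C ≟ᴸ C = yes refl

isI : Label → Bool
isI I = true
isI _ = false

isI-true : ∀ {l} → isI l ≡ true → l ≡ I
isI-true {I} _ = refl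

isI-≢ : ∀ {l} → l ≢ I → isI l ≡ false
isI-≢ {O} _ = refl
isI-≢ {I} l≢I = ⊥-elim (l≢I refl)
isI-≢ {C} _ = refl

isO : Label → Bool
isO O = true
isO _ = false

isO-true : ∀ {l} → isO l ≡ true → l ≡ O
isO-true {O} _ = refl

≡true-ext : ∀ {a b} → (a ≡ true → b ≡ true) → (b ≡ true → a ≡ true) → a ≡ b
≡true-ext {false} {false} _ _ = refl
≡true-ext {false} {true} _ b⇒a = b⇒a refl
≡true-ext {true} {false} a⇒b _ = sym (a⇒b refl)
≡true-ext {true} {true} _ _ = refl

-- For an offending cover x ⋖ y, the least vertex containing x misses y.
fitting-filters⇒Closed : ∀ {n} {lab : Fin n → Label} → (∀ U → Fits lab U → IsFilter n U) → Closed lab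
fitting-filters⇒Closed {n} {lab} filters x y x⋖y with lab x ≟ᴸ O | lab y ≟ᴸ I
... | yes x-O | _ = inj₁ x-O
... | no _ | yes y-I = inj₂ y-I
... | no x≢O | no y≢I = ⊥-elim (true≢false (trans (sym y∈U) y∉U))
  where
  U : Subset n
  U = tabulate (λ j → isI (lab j) ∨ δ x j)
  lookup-U : ∀ j → lookup U j ≡ isI (lab j) ∨ δ x j
  lookup-U = lookup∘tabulate (λ j → isI (lab j) ∨ δ x j)
  U-fits : Fits lab U
  U-fits j rewrite lookup-U j with lab j in e
  ... | O rewrite δ-≢ {i = x} {j} (λ x≡j → x≢O (trans (cong lab x≡j) e)) = refl
  ... | I = refl
  ... | C = refl
  x∈U : lookup U x ≡ true
  x∈U = trans (lookup-U x) (trans (cong (isI (lab x) ∨_) (δ-refl x)) (∨-zeroʳ _))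
  y∈U : lookup U y ≡ true
  y∈U = []=⇒lookup (filters U U-fits x y (x⋖y ◅ ε) (lookup⇒[]= x U x∈U))
  y∉U : lookup U y ≡ false
  y∉U = trans (lookup-U y) (cong₂ _∨_ (isI-≢ y≢I) (δ-≢ (Cover-irreflexive x⋖y)))

-- A chart presents the cube of lab as the affine image of Q_k with base point v and coordinates c.
record Chart {n k : ℕ} (lab : Fin n → Label) (v : Subset n) (c : Fin k → Fin n) : Set where
  field
    injective : ∀ {i i′} → c i ≡ c i′ → i ≡ i′
    free : ∀ i → lab (c i) ≡ C
    onto-free : ∀ j → lab j ≡ C → ∃[ i ] c i ≡ j
    base-I : ∀ j → lab j ≡ I → lookup v j ≡ true
    base-O : ∀ j → lab j ≡ O → lookup v j ≡ false

affine : ∀ {k n} → Subset n → (Fin k → Fin n) → Subset k → Subset n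
affine v c a = tabulate (λ j → lookup v j xor linear c a j)

lookup-affine : ∀ {k n} (v : Subset n) (c : Fin k → Fin n) a j → lookup (affine v c a) j ≡ lookup v j xor linear c a j
lookup-affine v c a = lookup∘tabulate (λ j → lookup v j xor linear c a j)

module ChartCube {n k : ℕ} {lab : Fin n → Label} {v : Subset n} {c : Fin k → Fin n} (chart : Chart lab v c) where
  open Chart chart

  not-free⇒outside : ∀ {j} → lab j ≢ C → ∀ i → c i ≢ j
  not-free⇒outside lab-j≢C i e = lab-j≢C (subst (λ x → lab x ≡ C) e (free i))

  affine-O : ∀ a {j} → lab j ≡ O → lookup (affine v c a) j ≡ false
  affine-O a {j} e = trans (lookup-affine v c a j)
    (cong₂ _xor_ (base-O j e) (linear-outside c j (not-free⇒outside (λ e′ → O≢C (trans (sym e) e′))) a))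

  affine-I : ∀ a {j} → lab j ≡ I → lookup (affine v c a) j ≡ true
  affine-I a {j} e = trans (lookup-affine v c a j)
    (cong₂ _xor_ (base-I j e) (linear-outside c j (not-free⇒outside (λ e′ → I≢C (trans (sym e) e′))) a))

  affine-free : ∀ a i → lookup (affine v c a) (c i) ≡ lookup v (c i) xor lookup a i
  affine-free a i = trans (lookup-affine v c a (c i)) (cong (lookup v (c i) xor_) (linear-at injective a i))

  affine-fits : ∀ a → Fits lab (affine v c a)
  affine-fits a j with lab j in e
  ... | O rewrite affine-O a e = refl
  ... | I rewrite affine-I a e = refl
  ... | C = refl

  coordinates : Subset n → Subset k
  coordinates U = tabulate (λ i → lookup v (c i) xor lookup U (c i))

  affine-coordinates : ∀ {U} → Fits lab U → affine v c (coordinates U) ≡ U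
  affine-coordinates {U} U-fits = lookup-extensionality λ j → pointwise j (U-fits j)
    where
    pointwise : ∀ j → fits (lab j) (lookup U j) ≡ true → lookup (affine v c (coordinates U)) j ≡ lookup U j
    pointwise j fits-j with lab j in e
    ... | O = trans (affine-O (coordinates U) e) (sym (trans (sym (not-involutive _)) (cong not fits-j)))
    ... | I = trans (affine-I (coordinates U) e) (sym fits-j)
    ... | C with onto-free j e
    ...   | i , refl = begin
      lookup (affine v c (coordinates U)) (c i)                     ≡⟨ affine-free (coordinates U) i ⟩
      lookup v (c i) xor lookup (coordinates U) i                    ≡⟨ cong (lookup v (c i) xor_) (lookup∘tabulate _ i) ⟩
      lookup v (c i) xor (lookup v (c i) xor lookup U (c i))         ≡⟨ xor-cancelˡ (lookup v (c i)) (lookup U (c i)) ⟩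
      lookup U (c i)                                                 ∎
      where open ≡-Reasoning

  affine-injective : Injective _≡_ _≡_ (affine v c)
  affine-injective {a} {b} e = lookup-extensionality λ i → xor-injectiveʳ (lookup v (c i))
    (trans (sym (affine-free a i)) (trans (cong (λ u → lookup u (c i)) e) (affine-free b i)))

  affine-xor : ∀ a b j → lookup (affine v c a) j xor lookup (affine v c b) j ≡ linear c (zipWith _xor_ a b) j
  affine-xor a b j = begin
    lookup (affine v c a) j xor lookup (affine v c b) j                 ≡⟨ cong₂ _xor_ (lookup-affine v c a j) (lookup-affine v c b j) ⟩
    (lookup v j xor linear c a j) xor (lookup v j xor linear c b j)     ≡⟨ xor-cancel-common (lookup v j) (linear c a j) (linear c b j) ⟩
    linear c a j xor linear c b j                                       ≡⟨ linear-xor c a b j ⟩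
    linear c (zipWith _xor_ a b) j                                      ∎
    where open ≡-Reasoning

  affine-adjacent : ∀ a b → Adj1 (affine v c a) (affine v c b) ⇔ Adj1 a b
  affine-adjacent a b = mk⇔ reflect preserve
    where
    preserve : Adj1 a b → Adj1 (affine v c a) (affine v c b)
    preserve a~b with Adj1⇒DifferAt a b a~b
    ... | r , differ = DifferAt⇒Adj1 (affine v c a) (affine v c b) (c r) λ j → begin
      lookup (affine v c a) j xor lookup (affine v c b) j   ≡⟨ affine-xor a b j ⟩
      linear c (zipWith _xor_ a b) j                        ≡⟨ cong (λ z → linear c z j) a⊕b≡e ⟩
      linear c ⁅ r ⁆ j                                      ≡⟨ linear-⁅⁆ c r j ⟩
      δ (c r) j                                             ∎
      where
      open ≡-Reasoning
      a⊕b≡e : zipWith _xor_ a b ≡ ⁅ r ⁆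
      a⊕b≡e = lookup-extensionality λ i → trans (lookup-zipWith _xor_ i a b) (trans (differ i) (sym (lookup-⁅⁆ r i)))
    reflect : Adj1 (affine v c a) (affine v c b) → Adj1 a b
    reflect fa~fb with Adj1⇒DifferAt (affine v c a) (affine v c b) fa~fb
    ... | s , differ = DifferAt⇒Adj1 a b i₀ λ i → begin
      lookup a i xor lookup b i                  ≡⟨ sym (lookup-zipWith _xor_ i a b) ⟩
      lookup (zipWith _xor_ a b) i               ≡⟨ sym (linear-at injective (zipWith _xor_ a b) i) ⟩
      linear c (zipWith _xor_ a b) (c i)         ≡⟨ sym (affine-xor a b (c i)) ⟩
      lookup (affine v c a) (c i) xor lookup (affine v c b) (c i)  ≡⟨ differ (c i) ⟩
      δ s (c i)                                  ≡⟨ cong (λ x → δ x (c i)) (sym c-i₀≡s) ⟩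
      δ (c i₀) (c i)                             ≡⟨ δ-injective injective i₀ i ⟩
      δ i₀ i                                     ∎
      where
      open ≡-Reasoning
      s∈image : ∃[ i ] c i ≡ s
      s∈image = linear-true⇒∈image c (zipWith _xor_ a b) s
        (trans (sym (affine-xor a b s)) (trans (differ s) (δ-refl s)))
      i₀ : Fin k
      i₀ = proj₁ s∈image
      c-i₀≡s : c i₀ ≡ s
      c-i₀≡s = proj₂ s∈image

  chart-cube : Closed lab → IsCube n k (vertices lab)
  chart-cube closed = affine v c , affine-filter , (λ a → Fits⇒∈vertices lab (affine v c a) (affine-fits a))
                    , (λ U U∈ → coordinates U , affine-coordinates (∈vertices⇒Fits lab U U∈))
                    , affine-injective , affine-adjacent
    where
    affine-filter : ∀ a → IsFilter n (affine v c a)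
    affine-filter a = cover-closed⇒IsFilter (affine v c a) λ x y x⋖y x∈ →
      [ (λ x-O → ⊥-elim (true≢false (trans (sym x∈) (affine-O a x-O)))) , affine-I a ]′ (closed x y x⋖y)

classify : ∀ {p} {P : Set p} → Dec P → Bool → Label
classify (yes _) _ = C
classify (no _) true = I
classify (no _) false = O

classify-C : ∀ {p} {P : Set p} (p? : Dec P) b → classify p? b ≡ C → P
classify-C (yes p) _ _ = p
classify-C (no _) true ()
classify-C (no _) false ()

classify-I : ∀ {p} {P : Set p} (p? : Dec P) b → classify p? b ≡ I → b ≡ true
classify-I (no _) true _ = refl
classify-I (no _) false ()

classify-O : ∀ {p} {P : Set p} (p? : Dec P) b → classify p? b ≡ O → b ≡ false
classify-O (no _) true ()
classify-O (no _) false _ = refl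

ChartedCube : (n k : ℕ) → VSet n → Set
ChartedCube n k S =
  Σ[ lab ∈ (Fin n → Label) ] Σ[ v ∈ Subset n ] Σ[ c ∈ (Fin k → Fin n) ] (Chart lab v c × Closed lab × S ≐ vertices lab)

cube-chart : ∀ {n k S} → IsCube n k S → ChartedCube n k S
cube-chart {n} {k} {S} (f , f-filter , f-∈ , f-onto , f-injective , f-adjacent) = lab , v , c , chart , closed , S≐
  where
  f-affine : ∃[ c ] IsAffine f c
  f-affine = cube-embedding-affine k f f-injective λ a b r differ →
    Adj1⇒DifferAt (f a) (f b) (Equivalence.from (f-adjacent a b) (DifferAt⇒Adj1 a b r differ))
  v : Subset n
  v = f ⊥
  c : Fin k → Fin n
  c = proj₁ f-affine
  f≡affine : ∀ a → f a ≡ affine v c a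
  f≡affine a = lookup-extensionality λ j → trans (proj₂ f-affine a j) (sym (lookup-affine v c a j))
  c-injective : ∀ {i i′} → c i ≡ c i′ → i ≡ i′
  c-injective {i} {i′} e = ⁅⁆-injective (f-injective (lookup-extensionality λ j →
    trans (proj₂ f-affine ⁅ i ⁆ j) (trans (cong (lookup v j xor_) (trans (linear-⁅⁆ c i j)
      (trans (cong (λ x → δ x j) e) (sym (linear-⁅⁆ c i′ j))))) (sym (proj₂ f-affine ⁅ i′ ⁆ j)))))
  lab : Fin n → Label
  lab j = classify (any? (λ i → c i ≟ j)) (lookup v j)
  chart : Chart lab v c
  chart = record
    { injective = c-injective
    ; free = λ i → cong (λ d → classify d (lookup v (c i))) (proj₂ (dec-yes (any? (λ i′ → c i′ ≟ c i)) (i , refl)))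
    ; onto-free = λ j → classify-C (any? (λ i → c i ≟ j)) (lookup v j)
    ; base-I = λ j → classify-I (any? (λ i → c i ≟ j)) (lookup v j)
    ; base-O = λ j → classify-O (any? (λ i → c i ≟ j)) (lookup v j)
    }
  open ChartCube chart
  fits⇒≡f : ∀ U → Fits lab U → f (coordinates U) ≡ U
  fits⇒≡f U U-fits = trans (f≡affine (coordinates U)) (affine-coordinates U-fits)
  closed : Closed lab
  closed = fitting-filters⇒Closed λ U U-fits → subst (IsFilter n) (fits⇒≡f U U-fits) (f-filter (coordinates U))
  S≐ : S ≐ vertices lab
  S≐ U = ≡true-ext
    (λ U∈S → let (a , fa≡U) = f-onto U U∈S in
      Fits⇒∈vertices lab U (subst (Fits lab) (trans (sym (f≡affine a)) fa≡U) (affine-fits a)))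
    (λ U∈V → subst (_∈V S) (fits⇒≡f U (∈vertices⇒Fits lab U U∈V)) (f-∈ (coordinates U)))

bottom : ∀ {n} → (Fin n → Label) → Subset n
bottom lab = tabulate (isI ∘ lab)

top : ∀ {n} → (Fin n → Label) → Subset n
top lab = tabulate (not ∘ isO ∘ lab)

bottom-fits : ∀ {n} (lab : Fin n → Label) → Fits lab (bottom lab)
bottom-fits lab j rewrite lookup∘tabulate (isI ∘ lab) j with lab j
... | O = refl
... | I = refl
... | C = refl

top-fits : ∀ {n} (lab : Fin n → Label) → Fits lab (top lab)
top-fits lab j rewrite lookup∘tabulate (not ∘ isO ∘ lab) j with lab j
... | O = refl
... | I = refl
... | C = refl

vertices-⊆⇒I : ∀ {n} (lab lab′ : Fin n → Label) → vertices lab ⊆V vertices lab′ → ∀ j → lab′ j ≡ I → lab j ≡ I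
vertices-⊆⇒I lab lab′ ⊆ j e = isI-true (trans (sym (lookup∘tabulate (isI ∘ lab) j))
  (subst (λ l → fits l (lookup (bottom lab) j) ≡ true) e
    (∈vertices⇒Fits lab′ (bottom lab) (⊆ (bottom lab) (Fits⇒∈vertices lab (bottom lab) (bottom-fits lab))) j)))

vertices-⊆⇒O : ∀ {n} (lab lab′ : Fin n → Label) → vertices lab ⊆V vertices lab′ → ∀ j → lab′ j ≡ O → lab j ≡ O
vertices-⊆⇒O lab lab′ ⊆ j e = isO-true (trans (sym (not-involutive _)) (trans (cong not (sym (lookup∘tabulate (not ∘ isO ∘ lab) j)))
  (subst (λ l → fits l (lookup (top lab) j) ≡ true) e
    (∈vertices⇒Fits lab′ (top lab) (⊆ (top lab) (Fits⇒∈vertices lab (top lab) (top-fits lab))) j))))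

vertices-injective : ∀ {n} {lab lab′ : Fin n → Label} → vertices lab ≐ vertices lab′ → ∀ j → lab j ≡ lab′ j
vertices-injective {lab = lab} {lab′} same = labels-agree (λ U → trans (sym (same U))) (λ U → trans (same U))
  where
  labels-agree : vertices lab ⊆V vertices lab′ → vertices lab′ ⊆V vertices lab → ∀ j → lab j ≡ lab′ j
  labels-agree ⊆ ⊇ j with lab j in e | lab′ j in e′
  ... | O | O = refl
  ... | I | I = refl
  ... | C | C = refl
  ... | O | I = ⊥-elim (O≢I (trans (sym e) (vertices-⊆⇒I lab lab′ ⊆ j e′)))
  ... | O | C = ⊥-elim (O≢C (trans (sym (vertices-⊆⇒O lab′ lab ⊇ j e)) e′))
  ... | I | O = ⊥-elim (O≢I (trans (sym (vertices-⊆⇒O lab lab′ ⊆ j e′)) e))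
  ... | I | C = ⊥-elim (I≢C (trans (sym (vertices-⊆⇒I lab′ lab ⊇ j e)) e′))
  ... | C | O = ⊥-elim (O≢C (trans (sym (vertices-⊆⇒O lab lab′ ⊆ j e′)) e))
  ... | C | I = ⊥-elim (I≢C (trans (sym (vertices-⊆⇒I lab lab′ ⊆ j e′)) e))

Freeable : ∀ {n} → (Fin n → Label) → Fin n → Set
Freeable {n} lab x = lab x ≢ C × (∀ y → Cover n x y → lab y ≡ I) × (∀ y → Cover n y x → lab y ≡ O)

freeAt : ∀ {n} → Fin n → (Fin n → Label) → Fin n → Label
freeAt x lab j = if δ x j then C else lab j

module _ {n} {lab : Fin n → Label} {x : Fin n} where

  freeAt-≡ : freeAt x lab x ≡ C
  freeAt-≡ rewrite δ-refl x = refl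

  freeAt-≢ : ∀ {j} → x ≢ j → freeAt x lab j ≡ lab j
  freeAt-≢ x≢j rewrite δ-≢ x≢j = refl

  vertices-⊆-freeAt : vertices lab ⊆V vertices (freeAt x lab)
  vertices-⊆-freeAt U U∈ = Fits⇒∈vertices (freeAt x lab) U λ j → fits′ j (∈vertices⇒Fits lab U U∈ j)
    where
    fits′ : ∀ j → fits (lab j) (lookup U j) ≡ true → fits (freeAt x lab j) (lookup U j) ≡ true
    fits′ j fits-j with x ≟ j
    ... | yes _ = refl
    ... | no _ = fits-j

  Closed-freeAt : Closed lab → Freeable lab x → Closed (freeAt x lab)
  Closed-freeAt closed (_ , up , down) y z y⋖z = by-position (x ≟ y) (x ≟ z)
    where
    by-position : Dec (x ≡ y) → Dec (x ≡ z) → freeAt x lab y ≡ O ⊎ freeAt x lab z ≡ I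
    by-position (yes refl) _ = inj₂ (trans (freeAt-≢ (Cover-irreflexive y⋖z)) (up z y⋖z))
    by-position (no x≢y) (yes refl) = inj₁ (trans (freeAt-≢ x≢y) (down y y⋖z))
    by-position (no x≢y) (no x≢z) = Sum.map (trans (freeAt-≢ x≢y)) (trans (freeAt-≢ x≢z)) (closed y z y⋖z)

  Chart-freeAt : ∀ {k v} {c : Fin k → Fin n} → Chart lab v c → lab x ≢ C → Chart (freeAt x lab) v (x ∷ᶠ c)
  Chart-freeAt {v = v} {c} chart x-not-free = record
    { injective = injective′
    ; free = λ { zero → freeAt-≡ ; (suc i) → trans (freeAt-≢ (x≢c i)) (free i) }
    ; onto-free = onto-free′
    ; base-I = λ j e → base-I j (trans (sym (freeAt-≢ (not-free⇒≢ (λ e′ → I≢C (trans (sym e) e′))))) e)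
    ; base-O = λ j e → base-O j (trans (sym (freeAt-≢ (not-free⇒≢ (λ e′ → O≢C (trans (sym e) e′))))) e)
    }
    where
    open Chart chart
    x≢c : ∀ i → x ≢ c i
    x≢c i e = x-not-free (trans (cong lab e) (free i))
    not-free⇒≢ : ∀ {j} → freeAt x lab j ≢ C → x ≢ j
    not-free⇒≢ not-free refl = not-free freeAt-≡
    injective′ : ∀ {i i′} → (x ∷ᶠ c) i ≡ (x ∷ᶠ c) i′ → i ≡ i′
    injective′ {zero} {zero} _ = refl
    injective′ {zero} {suc i′} e = ⊥-elim (x≢c i′ e)
    injective′ {suc i} {zero} e = ⊥-elim (x≢c i (sym e))
    injective′ {suc i} {suc i′} e = cong suc (injective e)
    onto-free′ : ∀ j → freeAt x lab j ≡ C → ∃[ i ] (x ∷ᶠ c) i ≡ j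
    onto-free′ j e with x ≟ j
    ... | yes x≡j = zero , x≡j
    ... | no _ = let (i , cᵢ≡j) = onto-free j e in suc i , cᵢ≡j

free-coordinate : ∀ {n k} {lab : Fin n → Label} {v c} → Chart lab v c → Closed lab → ∀ {x} → Freeable lab x →
  ∃[ T ] (IsCube n (ℕ.suc k) T × vertices lab ⊆V T)
free-coordinate {lab = lab} chart closed {x} freeable =
  vertices (freeAt x lab) , ChartCube.chart-cube (Chart-freeAt chart (proj₁ freeable)) (Closed-freeAt closed freeable) , vertices-⊆-freeAt {lab = lab} {x}

maximal-cube⇒labelling : ∀ {n S} → IsMaximalCube n S → Σ[ lab ∈ (Fin n → Label) ] (IsMaximalLabelling lab × S ≐ vertices lab)
maximal-cube⇒labelling {n} {S} (k , cube , no-larger) with cube-chart cube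
... | lab , _ , _ , chart , closed , S≐ = lab , (closed , O-rigid′ , I-rigid′) , S≐
  where
  not-freeable : ∀ {x} → ¬ Freeable lab x
  not-freeable freeable =
    let (T , T-cube , ⊆T) = free-coordinate chart closed freeable
    in no-larger (ℕ.suc k , T , n<1+n k , T-cube , λ U U∈S → ⊆T U (trans (sym (S≐ U)) U∈S))
  O-rigid′ : O-rigid lab
  O-rigid′ x x-O (up , down) = not-freeable (O≢C ∘ trans (sym x-O) , up , down)
  I-rigid′ : I-rigid lab
  I-rigid′ x x-I down = not-freeable (I≢C ∘ trans (sym x-I) , up , down)
    where
    up : ∀ y → Cover n x y → lab y ≡ I
    up y x⋖y = [ (λ x-O → ⊥-elim (O≢I (trans (sym x-O) x-I))) , (λ y-I → y-I) ]′ (closed x y x⋖y)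

free-enumeration : ∀ {n} (lab : Fin n → Label) → ∃[ k ] Σ[ c ∈ (Fin k → Fin n) ]
  ((∀ {i i′} → c i ≡ c i′ → i ≡ i′) × (∀ i → lab (c i) ≡ C) × (∀ j → lab j ≡ C → ∃[ i ] c i ≡ j))
free-enumeration {ℕ.zero} lab = 0 , (λ ()) , (λ { {()} }) , (λ ()) , (λ ())
free-enumeration {ℕ.suc n} lab with free-enumeration (lab ∘ suc) | lab zero ≟ᴸ C
... | k , c , injective , free , onto-free | yes lab₀-C = ℕ.suc k , zero ∷ᶠ (suc ∘ c) , injective′ , free′ , onto-free′
  where
  injective′ : ∀ {i i′} → (zero ∷ᶠ (suc ∘ c)) i ≡ (zero ∷ᶠ (suc ∘ c)) i′ → i ≡ i′
  injective′ {zero} {zero} _ = refl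
  injective′ {suc i} {suc i′} e = cong suc (injective (suc-injective e))
  free′ : ∀ i → lab ((zero ∷ᶠ (suc ∘ c)) i) ≡ C
  free′ zero = lab₀-C
  free′ (suc i) = free i
  onto-free′ : ∀ j → lab j ≡ C → ∃[ i ] (zero ∷ᶠ (suc ∘ c)) i ≡ j
  onto-free′ zero _ = zero , refl
  onto-free′ (suc j) e = let (i , cᵢ≡j) = onto-free j e in suc i , cong suc cᵢ≡j
... | k , c , injective , free , onto-free | no lab₀≢C = k , suc ∘ c , injective ∘ suc-injective , free , onto-free′
  where
  onto-free′ : ∀ j → lab j ≡ C → ∃[ i ] suc (c i) ≡ j
  onto-free′ zero e = ⊥-elim (lab₀≢C e)
  onto-free′ (suc j) e = let (i , cᵢ≡j) = onto-free j e in i , cong suc cᵢ≡j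

maximal⇒¬Freeable : ∀ {n} {lab : Fin n → Label} → IsMaximalLabelling lab → ∀ x → ¬ Freeable lab x
maximal⇒¬Freeable {lab = lab} (_ , O-rigid′ , I-rigid′) x (x-not-free , up , down) with lab x in e
... | O = O-rigid′ x e (up , down)
... | I = I-rigid′ x e down
... | C = x-not-free refl

supercube-coordinate-Freeable : ∀ {n} {lab lab′ : Fin n → Label} → Closed lab′ → vertices lab ⊆V vertices lab′ →
  ∀ {x} → lab′ x ≡ C → lab x ≢ C → Freeable lab x
supercube-coordinate-Freeable {lab = lab} {lab′} closed′ ⊆ {x} x-free′ x-not-free = x-not-free , up , down
  where
  up : ∀ y → Cover _ x y → lab y ≡ I
  up y x⋖y = [ (λ x-O → ⊥-elim (O≢C (trans (sym x-O) x-free′))) , vertices-⊆⇒I lab lab′ ⊆ y ]′ (closed′ x y x⋖y)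
  down : ∀ y → Cover _ y x → lab y ≡ O
  down y y⋖x = [ vertices-⊆⇒O lab lab′ ⊆ y , (λ x-I → ⊥-elim (I≢C (trans (sym x-I) x-free′))) ]′ (closed′ y x y⋖x)

labelling⇒maximal-cube : ∀ {n} {lab : Fin n → Label} → IsMaximalLabelling lab → IsMaximalCube n (vertices lab)
labelling⇒maximal-cube {n} {lab} maximal@(closed , _) with free-enumeration lab
... | k , c , injective , free , onto-free = k , ChartCube.chart-cube chart closed , no-larger
  where
  chart : Chart lab (bottom lab) c
  chart = record
    { injective = injective ; free = free ; onto-free = onto-free
    ; base-I = λ j e → trans (lookup∘tabulate (isI ∘ lab) j) (cong isI e)
    ; base-O = λ j e → trans (lookup∘tabulate (isI ∘ lab) j) (cong isI e)
    }
  no-larger : ¬ (∃[ k′ ] ∃[ T ] (k < k′ × IsCube n k′ T × vertices lab ⊆V T))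
  no-larger (k′ , T , k<k′ , T-cube , ⊆T) with cube-chart T-cube
  ... | lab′ , _ , c′ , chart′ , closed′ , T≐ =
    maximal⇒¬Freeable maximal (c′ i) (supercube-coordinate-Freeable closed′ ⊆ (Chart.free chart′ i) lab-cᵢ≢C)
    where
    ⊆ : vertices lab ⊆V vertices lab′
    ⊆ U U∈ = trans (sym (T≐ U)) (⊆T U U∈)
    index : (∀ i → lab (c′ i) ≡ C) → Fin k′ → Fin k
    index all-free i = proj₁ (onto-free (c′ i) (all-free i))
    -- Pigeonhole: the k′ > k coordinates of T cannot all be among the k free elements of lab.
    not-all-free : ¬ (∀ i → lab (c′ i) ≡ C)
    not-all-free all-free with pigeonhole k<k′ (index all-free)
    ... | i , i′ , i<i′ , same = <⇒≢ i<i′ (Chart.injective chart′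
      (trans (sym (proj₂ (onto-free (c′ i) (all-free i)))) (trans (cong c same) (proj₂ (onto-free (c′ i′) (all-free i′))))))
    i : Fin k′
    i = proj₁ (¬∀⟶∃¬ k′ (λ i → lab (c′ i) ≡ C) (λ i → lab (c′ i) ≟ᴸ C) not-all-free)
    lab-cᵢ≢C : lab (c′ i) ≢ C
    lab-cᵢ≢C = proj₂ (¬∀⟶∃¬ k′ (λ i → lab (c′ i) ≡ C) (λ i → lab (c′ i) ≟ᴸ C) not-all-free)

-- The S-fence

even : ℕ → Bool
even ℕ.zero = true
even (ℕ.suc n) = not (even n)

-- The label forced on a non-coordinate element of the zigzag tail: I on maxima, O on minima.
natural : ℕ → Label
natural x = if even x then I else O

natural≢C : ∀ x → natural x ≢ C
natural≢C x with even x
... | true = I≢C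
... | false = O≢C

natural-even : ∀ {x} → even x ≡ true → natural x ≡ I
natural-even {x} e rewrite e = refl

natural-odd : ∀ {x} → even x ≡ false → natural x ≡ O
natural-odd {x} e rewrite e = refl

natural-I⇒even : ∀ {x} → natural x ≡ I → even x ≡ true
natural-I⇒even {x} e with even x
... | true = refl

natural-O⇒odd : ∀ {x} → natural x ≡ O → even x ≡ false
natural-O⇒odd {x} e with even x
... | false = refl

2*suc+ : ∀ m k → 2 * ℕ.suc m + k ≡ 2 + (2 * m + k)
2*suc+ m k = cong (_+ k) (*-suc 2 m)

even-2*+ : ∀ m k → even (2 * m + k) ≡ even k
even-2*+ ℕ.zero k = refl
even-2*+ (ℕ.suc m) k = trans (cong even (2*suc+ m k)) (trans (not-involutive _) (even-2*+ m k))

cover-positive : ∀ {i j} → CoverIdx i j → 1 ≤ i × 1 ≤ j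
cover-positive c21 = s≤s z≤n , s≤s z≤n
cover-positive c32 = s≤s z≤n , s≤s z≤n
cover-positive c24 = s≤s z≤n , s≤s z≤n
cover-positive c54 = s≤s z≤n , s≤s z≤n
cover-positive (cOdd m) = ≤-trans (s≤s z≤n) (m≤n+m 5 (2 * m)) , ≤-trans (s≤s z≤n) (m≤n+m 6 (2 * m))
cover-positive (cOdd' m) = ≤-trans (s≤s z≤n) (m≤n+m 7 (2 * m)) , ≤-trans (s≤s z≤n) (m≤n+m 6 (2 * m))

cover-from-head : ∀ {i j} → CoverIdx i j → i ≤ 2 → j ≤ 4
cover-from-head c21 _ = s≤s z≤n
cover-from-head c24 _ = ≤-refl
cover-from-head c32 (s≤s (s≤s ()))
cover-from-head c54 (s≤s (s≤s ()))
cover-from-head (cOdd m) i≤2 with ≤-trans (m≤n+m 5 (2 * m)) i≤2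
... | s≤s (s≤s ())
cover-from-head (cOdd' m) i≤2 with ≤-trans (m≤n+m 7 (2 * m)) i≤2
... | s≤s (s≤s ())

cover-parity : ∀ {i j} → CoverIdx i j → 3 ≤ i → even i ≡ false × even j ≡ true
cover-parity c21 (s≤s (s≤s ()))
cover-parity c24 (s≤s (s≤s ()))
cover-parity c32 _ = refl , refl
cover-parity c54 _ = refl , refl
cover-parity (cOdd m) _ = even-2*+ m 5 , even-2*+ m 6
cover-parity (cOdd' m) _ = even-2*+ m 7 , even-2*+ m 6

natural-lower : ∀ {i j} → CoverIdx i j → 3 ≤ i → natural i ≡ O
natural-lower {i} i⋖j 3≤i = natural-odd {i} (proj₁ (cover-parity i⋖j 3≤i))

natural-upper : ∀ {i j} → CoverIdx i j → 3 ≤ i → natural j ≡ I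
natural-upper {j = j} i⋖j 3≤i = natural-even {j} (proj₂ (cover-parity i⋖j 3≤i))

cover-adjacent : ∀ {i j} → CoverIdx i j → 3 ≤ i → j ≡ ℕ.suc i ⊎ ℕ.suc j ≡ i
cover-adjacent c21 (s≤s (s≤s ()))
cover-adjacent c24 (s≤s (s≤s ()))
cover-adjacent c32 _ = inj₂ refl
cover-adjacent c54 _ = inj₂ refl
cover-adjacent (cOdd m) _ = inj₁ (+-suc (2 * m) 5)
cover-adjacent (cOdd' m) _ = inj₂ (sym (+-suc (2 * m) 6))

cover-shift : ∀ {i j} → CoverIdx i j → 3 ≤ i → CoverIdx (2 + i) (2 + j)
cover-shift c21 (s≤s (s≤s ()))
cover-shift c24 (s≤s (s≤s ()))
cover-shift c32 _ = c54
cover-shift c54 _ = cOdd' 0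
cover-shift (cOdd m) _ = subst₂ CoverIdx (2*suc+ m 5) (2*suc+ m 6) (cOdd (ℕ.suc m))
cover-shift (cOdd' m) _ = subst₂ CoverIdx (2*suc+ m 7) (2*suc+ m 6) (cOdd' (ℕ.suc m))

-- From x₄ on, φ is the zigzag x₄ > x₅ < x₆ > x₇ < ⋯.
cover-step : ∀ x → 4 ≤ x → (even x ≡ true → CoverIdx (ℕ.suc x) x) × (even x ≡ false → CoverIdx x (ℕ.suc x))
cover-step 0 ()
cover-step 1 (s≤s ())
cover-step 2 (s≤s (s≤s ()))
cover-step 3 (s≤s (s≤s (s≤s ())))
cover-step 4 _ = (λ _ → c54) , (λ ())
cover-step 5 _ = (λ ()) , (λ _ → cOdd 0)
cover-step (ℕ.suc (ℕ.suc (ℕ.suc (ℕ.suc (ℕ.suc (ℕ.suc y)))))) _ =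
  (λ e → cover-shift (proj₁ (cover-step (ℕ.suc (ℕ.suc (ℕ.suc (ℕ.suc y)))) (s≤s (s≤s (s≤s (s≤s z≤n)))))
                      (trans (sym (not-involutive _)) e)) (s≤s (s≤s (s≤s z≤n))))
  , (λ e → cover-shift (proj₂ (cover-step (ℕ.suc (ℕ.suc (ℕ.suc (ℕ.suc y)))) (s≤s (s≤s (s≤s (s≤s z≤n)))))
                      (trans (sym (not-involutive _)) e)) (s≤s (s≤s (s≤s z≤n))))

-- Labellings of φ_N as functions ℕ → Label read on 1, …, N

UpperI : ℕ → (ℕ → Label) → ℕ → Set
UpperI N w x = ∀ j → CoverIdx x j → j ≤ N → w j ≡ I

LowerO : ℕ → (ℕ → Label) → ℕ → Set
LowerO N w x = ∀ i → CoverIdx i x → i ≤ N → w i ≡ O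

Closedᴺ O-rigidᴺ I-rigidᴺ Maximalᴺ : ℕ → (ℕ → Label) → Set
Closedᴺ N w = ∀ i j → CoverIdx i j → i ≤ N → j ≤ N → w i ≡ O ⊎ w j ≡ I
O-rigidᴺ N w = ∀ x → 1 ≤ x → x ≤ N → w x ≡ O → ¬ (UpperI N w x × LowerO N w x)
I-rigidᴺ N w = ∀ x → 1 ≤ x → x ≤ N → w x ≡ I → ¬ LowerO N w x
Maximalᴺ N w = Closedᴺ N w × O-rigidᴺ N w × I-rigidᴺ N w

Agree : ℕ → (ℕ → Label) → (ℕ → Label) → Set
Agree N w w′ = ∀ x → 1 ≤ x → x ≤ N → w x ≡ w′ x

Agree-trans : ∀ {N u v w} → Agree N u v → Agree N v w → Agree N u w
Agree-trans u≈v v≈w x 1≤x x≤N = trans (u≈v x 1≤x x≤N) (v≈w x 1≤x x≤N)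

≤-suc-view : ∀ {x n} → x ≤ ℕ.suc n → x ≤ n ⊎ x ≡ ℕ.suc n
≤-suc-view x≤1+n = Sum.map₁ ℕ.s≤s⁻¹ (ℕₚ.m≤n⇒m<n∨m≡n x≤1+n)

≤2⊎3≤ : ∀ x → x ≤ 2 ⊎ 3 ≤ x
≤2⊎3≤ x with x ℕ.≤? 2
... | yes x≤2 = inj₁ x≤2
... | no x≰2 = inj₂ (ℕₚ.≰⇒> x≰2)

lower-from-tail : ∀ {i x} → CoverIdx i x → 5 ≤ x → 3 ≤ i
lower-from-tail i⋖x 5≤x with ≤2⊎3≤ _
... | inj₁ i≤2 = ⊥-elim (ℕₚ.≤⇒≯ (cover-from-head i⋖x i≤2) 5≤x)
... | inj₂ 3≤i = 3≤i

MaximalUpTo : ℕ → ℕ → (ℕ → Label) → Set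
MaximalUpTo K N w = Closedᴺ K w × (∀ x → 1 ≤ x → x ≤ K → w x ≡ O → ¬ (UpperI N w x × LowerO N w x))
                               × (∀ x → 1 ≤ x → x ≤ K → w x ≡ I → ¬ LowerO N w x)

transfer : ∀ {K N w w′} → K ≤ N → Maximalᴺ K w → Agree K w w′ → MaximalUpTo K N w′
transfer {K} {N} {w} {w′} K≤N (closed , O-rigid′ , I-rigid′) w≈w′ = closed′ , O-rigid″ , I-rigid″
  where
  restrict-up : ∀ {x} → UpperI N w′ x → UpperI K w x
  restrict-up up j x⋖j j≤K = trans (w≈w′ j (proj₂ (cover-positive x⋖j)) j≤K) (up j x⋖j (≤-trans j≤K K≤N))
  restrict-down : ∀ {x} → LowerO N w′ x → LowerO K w x
  restrict-down down i i⋖x i≤K = trans (w≈w′ i (proj₁ (cover-positive i⋖x)) i≤K) (down i i⋖x (≤-trans i≤K K≤N))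
  closed′ : Closedᴺ K w′
  closed′ i j i⋖j i≤K j≤K = Sum.map (trans (sym (w≈w′ i (proj₁ (cover-positive i⋖j)) i≤K)))
                                    (trans (sym (w≈w′ j (proj₂ (cover-positive i⋖j)) j≤K))) (closed i j i⋖j i≤K j≤K)
  O-rigid″ : ∀ x → 1 ≤ x → x ≤ K → w′ x ≡ O → ¬ (UpperI N w′ x × LowerO N w′ x)
  O-rigid″ x 1≤x x≤K e (up , down) = O-rigid′ x 1≤x x≤K (trans (w≈w′ x 1≤x x≤K) e) (restrict-up up , restrict-down down)
  I-rigid″ : ∀ x → 1 ≤ x → x ≤ K → w′ x ≡ I → ¬ LowerO N w′ x
  I-rigid″ x 1≤x x≤K e down = I-rigid′ x 1≤x x≤K (trans (w≈w′ x 1≤x x≤K) e) (restrict-down down)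

Maximalᴺ-cong : ∀ {N w w′} → Agree N w w′ → Maximalᴺ N w → Maximalᴺ N w′
Maximalᴺ-cong w≈w′ maximal = transfer ≤-refl maximal w≈w′

cover-reach : ∀ {i j K} → CoverIdx i j → i ≤ K → 4 ≤ K → j ≤ ℕ.suc K
cover-reach {i} {j} {K} i⋖j i≤K 4≤K with ≤2⊎3≤ i
... | inj₁ i≤2 = ≤-trans (cover-from-head i⋖j i≤2) (≤-trans 4≤K (n≤1+n K))
... | inj₂ 3≤i with cover-adjacent i⋖j 3≤i
...   | inj₁ j≡1+i = ≤-trans (≤-reflexive j≡1+i) (s≤s i≤K)
...   | inj₂ 1+j≡i = ≤-trans (≤-trans (n≤1+n j) (≤-reflexive 1+j≡i)) (≤-trans i≤K (n≤1+n K))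

upper-escape : ∀ {x j K} → 4 ≤ K → x ≤ K → ¬ (j ≤ K) → CoverIdx x j → j ≡ ℕ.suc K × 3 ≤ x
upper-escape {x} 4≤K x≤K j≰K x⋖j with ≤-suc-view (cover-reach x⋖j x≤K 4≤K) | ≤2⊎3≤ x
... | inj₁ j≤K | _ = ⊥-elim (j≰K j≤K)
... | inj₂ _ | inj₁ x≤2 = ⊥-elim (j≰K (≤-trans (cover-from-head x⋖j x≤2) 4≤K))
... | inj₂ j≡1+K | inj₂ 3≤x = j≡1+K , 3≤x

lower-escape : ∀ {i x K} → 4 ≤ K → x ≤ K → ¬ (i ≤ K) → CoverIdx i x → i ≡ ℕ.suc K × 3 ≤ i
lower-escape {i} {x} {K} 4≤K x≤K i≰K i⋖x with ≤2⊎3≤ i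
... | inj₁ i≤2 = ⊥-elim (i≰K (≤-trans i≤2 (≤-trans (s≤s (s≤s z≤n)) 4≤K)))
... | inj₂ 3≤i with cover-adjacent i⋖x 3≤i
...   | inj₁ x≡1+i = ⊥-elim (i≰K (≤-trans (≤-trans (n≤1+n i) (≤-reflexive (sym x≡1+i))) x≤K))
...   | inj₂ 1+x≡i with ≤-suc-view (≤-trans (≤-reflexive (sym 1+x≡i)) (s≤s x≤K))
...     | inj₁ i≤K = ⊥-elim (i≰K i≤K)
...     | inj₂ i≡1+K = i≡1+K , 3≤i

-- Since K ≥ 4, the only covers leaving 1, …, K go to K + 1; if that element carries its natural label,
-- they never obstruct anything.
restrict : ∀ {K N w} → 4 ≤ K → ℕ.suc K ≤ N → w (ℕ.suc K) ≡ natural (ℕ.suc K) → Maximalᴺ N w → Maximalᴺ K w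
restrict {K} {N} {w} 4≤K 1+K≤N natural-at (closed , O-rigid′ , I-rigid′) = closed′ , O-rigid″ , I-rigid″
  where
  K≤N : K ≤ N
  K≤N = ≤-trans (n≤1+n K) 1+K≤N
  closed′ : Closedᴺ K w
  closed′ i j i⋖j i≤K j≤K = closed i j i⋖j (≤-trans i≤K K≤N) (≤-trans j≤K K≤N)
  extend-up : ∀ {x} → x ≤ K → UpperI K w x → UpperI N w x
  extend-up x≤K up j x⋖j j≤N with j ℕ.≤? K
  ... | yes j≤K = up j x⋖j j≤K
  ... | no j≰K with upper-escape 4≤K x≤K j≰K x⋖j
  ...   | refl , 3≤x = trans natural-at (natural-upper x⋖j 3≤x)
  extend-down : ∀ {x} → x ≤ K → LowerO K w x → LowerO N w x
  extend-down x≤K down i i⋖x i≤N with i ℕ.≤? K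
  ... | yes i≤K = down i i⋖x i≤K
  ... | no i≰K with lower-escape 4≤K x≤K i≰K i⋖x
  ...   | refl , 3≤i = trans natural-at (natural-lower i⋖x 3≤i)
  O-rigid″ : O-rigidᴺ K w
  O-rigid″ x 1≤x x≤K e (up , down) = O-rigid′ x 1≤x (≤-trans x≤K K≤N) e (extend-up x≤K up , extend-down x≤K down)
  I-rigid″ : I-rigidᴺ K w
  I-rigid″ x 1≤x x≤K e down = I-rigid′ x 1≤x (≤-trans x≤K K≤N) e (extend-down x≤K down)

_[_≔_] : (ℕ → Label) → ℕ → Label → ℕ → Label
(w [ x ≔ l ]) y = if does (y ℕ.≟ x) then l else w y

override-≡ : ∀ w x l → (w [ x ≔ l ]) x ≡ l
override-≡ w x l rewrite dec-true (x ℕ.≟ x) refl = refl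

override-< : ∀ w {x} l y → y < x → (w [ x ≔ l ]) y ≡ w y
override-< w {x} l y y<x rewrite dec-false (y ℕ.≟ x) (ℕₚ.<⇒≢ y<x) = refl

extend₂ : ℕ → (ℕ → Label) → ℕ → Label
extend₂ K w = w [ 1 + K ≔ natural (1 + K) ] [ 2 + K ≔ C ]

extend₃ : ℕ → (ℕ → Label) → ℕ → Label
extend₃ K w = extend₂ K w [ 3 + K ≔ natural (3 + K) ]

module _ (K : ℕ) (w : ℕ → Label) where

  private
    w₁ : ℕ → Label
    w₁ = w [ 1 + K ≔ natural (1 + K) ]

  extend₂-below : ∀ {x} → x ≤ K → extend₂ K w x ≡ w x
  extend₂-below {x} x≤K = trans (override-< w₁ C x (s≤s (m≤n⇒m≤1+n x≤K))) (override-< w (natural (1 + K)) x (s≤s x≤K))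

  extend₂-1 : extend₂ K w (1 + K) ≡ natural (1 + K)
  extend₂-1 = trans (override-< w₁ C (1 + K) ≤-refl) (override-≡ w (1 + K) (natural (1 + K)))

  extend₂-2 : extend₂ K w (2 + K) ≡ C
  extend₂-2 = override-≡ w₁ (2 + K) C

  extend₃-below : ∀ {x} → x ≤ K → extend₃ K w x ≡ w x
  extend₃-below {x} x≤K = trans (override-< (extend₂ K w) (natural (3 + K)) x (s≤s (m≤n⇒m≤1+n (m≤n⇒m≤1+n x≤K)))) (extend₂-below x≤K)

  extend₃-1 : extend₃ K w (1 + K) ≡ natural (1 + K)
  extend₃-1 = trans (override-< (extend₂ K w) (natural (3 + K)) (1 + K) (n≤1+n (2 + K))) extend₂-1

  extend₃-2 : extend₃ K w (2 + K) ≡ C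
  extend₃-2 = trans (override-< (extend₂ K w) (natural (3 + K)) (2 + K) ≤-refl) extend₂-2

  extend₃-3 : extend₃ K w (3 + K) ≡ natural (3 + K)
  extend₃-3 = override-≡ (extend₂ K w) (3 + K) (natural (3 + K))

lower-cover-of-top : ∀ {i T} → CoverIdx i T → 5 ≤ T → i ≤ T → ℕ.suc i ≡ T
lower-cover-of-top i⋖T 5≤T i≤T with cover-adjacent i⋖T (lower-from-tail i⋖T 5≤T)
... | inj₁ T≡1+i = sym T≡1+i
... | inj₂ refl = ⊥-elim (1+n≰n i≤T)

upper-cover-of-top : ∀ {j T} → CoverIdx T j → 3 ≤ T → j ≤ T → ℕ.suc j ≡ T
upper-cover-of-top T⋖j 3≤T j≤T with cover-adjacent T⋖j 3≤T
... | inj₁ refl = ⊥-elim (1+n≰n j≤T)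
... | inj₂ 1+j≡T = 1+j≡T

upper-vacuous : ∀ {N w x} → even x ≡ true → 3 ≤ x → UpperI N w x
upper-vacuous x-even 3≤x j x⋖j _ with trans (sym (proj₁ (cover-parity x⋖j 3≤x))) x-even
... | ()

lower-vacuous : ∀ {N w x} → even x ≡ false → 5 ≤ x → LowerO N w x
lower-vacuous x-odd 5≤x i i⋖x _ with trans (sym (proj₂ (cover-parity i⋖x (lower-from-tail i⋖x 5≤x)))) x-odd
... | ()

Adjacent : ℕ → ℕ → Set
Adjacent x y = y ≡ ℕ.suc x ⊎ ℕ.suc y ≡ x

tail-cover : ∀ {x y} → 5 ≤ x → Adjacent x y → (even x ≡ false → CoverIdx x y) × (even x ≡ true → CoverIdx y x)
tail-cover {x} 5≤x (inj₁ refl) = proj₂ (cover-step x (≤-trans (n≤1+n 4) 5≤x)) , proj₁ (cover-step x (≤-trans (n≤1+n 4) 5≤x))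
tail-cover {y = y} (s≤s 4≤y) (inj₂ refl) =
  (λ odd → proj₁ (cover-step y 4≤y) (trans (sym (not-involutive (even y))) (cong not odd)))
  , (λ ev → proj₂ (cover-step y 4≤y) (trans (sym (not-involutive (even y))) (cong not ev)))

natural-end⇒closed : ∀ {w : ℕ → Label} {i j} → CoverIdx i j → 3 ≤ i → w i ≡ natural i ⊎ w j ≡ natural j → w i ≡ O ⊎ w j ≡ I
natural-end⇒closed i⋖j 3≤i (inj₁ e) = inj₁ (trans e (natural-lower i⋖j 3≤i))
natural-end⇒closed i⋖j 3≤i (inj₂ e) = inj₂ (trans e (natural-upper i⋖j 3≤i))

beside-free⇒natural : ∀ {N w x y} → Closedᴺ N w → x ≤ N → y ≤ N → 5 ≤ x → Adjacent x y → w y ≡ C → w x ≡ natural x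
beside-free⇒natural {w = w} {x} {y} closed x≤N y≤N 5≤x x~y y-free with even x in e
... | false = [ (λ x-O → x-O) , (λ y-I → ⊥-elim (I≢C (trans (sym y-I) y-free))) ]′
                (closed x y (proj₁ (tail-cover 5≤x x~y) e) x≤N y≤N)
... | true = [ (λ y-O → ⊥-elim (O≢C (trans (sym y-O) y-free))) , (λ x-I → x-I) ]′
                (closed y x (proj₂ (tail-cover 5≤x x~y) e) y≤N x≤N)

RigidAt : ℕ → (ℕ → Label) → ℕ → Set
RigidAt N w x = (w x ≡ O → ¬ (UpperI N w x × LowerO N w x)) × (w x ≡ I → ¬ LowerO N w x)

beside-free-rigid : ∀ {N w x y} → 5 ≤ x → Adjacent x y → y ≤ N → w y ≡ C → w x ≡ natural x → RigidAt N w x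
beside-free-rigid {x = x} 5≤x x~y y≤N y-free x-natural =
  (λ x-O (up , _) → I≢C (trans (sym (up _ (proj₁ (tail-cover 5≤x x~y) (natural-O⇒odd {x} (trans (sym x-natural) x-O))) y≤N)) y-free))
  , (λ x-I down → O≢C (trans (sym (down _ (proj₂ (tail-cover 5≤x x~y) (natural-I⇒even {x} (trans (sym x-natural) x-I))) y≤N)) y-free))

module _ {K : ℕ} (4≤K : 4 ≤ K) where

  private
    5≤1+K : 5 ≤ 1 + K
    5≤1+K = s≤s 4≤K
    5≤3+K : 5 ≤ 3 + K
    5≤3+K = m≤n⇒m≤1+n (m≤n⇒m≤1+n 5≤1+K)
    3≤1+K : 3 ≤ 1 + K
    3≤1+K = ≤-trans (n≤1+n 3) (m≤n⇒m≤1+n 4≤K)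
    3≤2+K : 3 ≤ 2 + K
    3≤2+K = m≤n⇒m≤1+n 3≤1+K
    3≤3+K : 3 ≤ 3 + K
    3≤3+K = m≤n⇒m≤1+n 3≤2+K

  extend₂-maximal : ∀ {w} → Maximalᴺ K w → Maximalᴺ (2 + K) (extend₂ K w)
  extend₂-maximal {w} maximal = closed , O-rigid′ , I-rigid′
    where
    w′ : ℕ → Label
    w′ = extend₂ K w
    old : MaximalUpTo K (2 + K) w′
    old = transfer (≤-trans (n≤1+n K) (n≤1+n (1 + K))) maximal (λ x _ x≤K → sym (extend₂-below K w x≤K))
    closed : Closedᴺ (2 + K) w′
    closed i j i⋖j i≤ j≤ with ≤-suc-view i≤
    ... | inj₂ refl with cover-adjacent i⋖j 3≤2+K
    ...   | inj₁ refl = ⊥-elim (1+n≰n j≤)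
    ...   | inj₂ refl = natural-end⇒closed {w = w′} i⋖j 3≤2+K (inj₂ (extend₂-1 K w))
    closed i j i⋖j i≤ j≤ | inj₁ i≤1+K with ≤-suc-view i≤1+K
    ... | inj₂ refl = natural-end⇒closed {w = w′} i⋖j 3≤1+K (inj₁ (extend₂-1 K w))
    ... | inj₁ i≤K with ≤-suc-view (cover-reach i⋖j i≤K 4≤K)
    ...   | inj₂ refl = natural-end⇒closed {w = w′} i⋖j (lower-from-tail i⋖j 5≤1+K) (inj₂ (extend₂-1 K w))
    ...   | inj₁ j≤K = proj₁ old i j i⋖j i≤K j≤K
    O-rigid′ : O-rigidᴺ (2 + K) w′
    O-rigid′ x 1≤x x≤ e with ≤-suc-view x≤
    ... | inj₂ refl = λ _ → O≢C (trans (sym e) (extend₂-2 K w))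
    ... | inj₁ x≤1+K with ≤-suc-view x≤1+K
    ...   | inj₂ refl = proj₁ (beside-free-rigid {w = w′} 5≤1+K (inj₁ refl) ≤-refl (extend₂-2 K w) (extend₂-1 K w)) e
    ...   | inj₁ x≤K = proj₁ (proj₂ old) x 1≤x x≤K e
    I-rigid′ : I-rigidᴺ (2 + K) w′
    I-rigid′ x 1≤x x≤ e with ≤-suc-view x≤
    ... | inj₂ refl = λ _ → I≢C (trans (sym e) (extend₂-2 K w))
    ... | inj₁ x≤1+K with ≤-suc-view x≤1+K
    ...   | inj₂ refl = proj₂ (beside-free-rigid {w = w′} 5≤1+K (inj₁ refl) ≤-refl (extend₂-2 K w) (extend₂-1 K w)) e
    ...   | inj₁ x≤K = proj₂ (proj₂ old) x 1≤x x≤K e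

  extend₃-maximal : ∀ {w} → Maximalᴺ K w → Maximalᴺ (3 + K) (extend₃ K w)
  extend₃-maximal {w} maximal = closed , O-rigid′ , I-rigid′
    where
    w′ : ℕ → Label
    w′ = extend₃ K w
    old : MaximalUpTo K (3 + K) w′
    old = transfer (≤-trans (n≤1+n K) (≤-trans (n≤1+n (1 + K)) (n≤1+n (2 + K)))) maximal (λ x _ x≤K → sym (extend₃-below K w x≤K))
    closed : Closedᴺ (3 + K) w′
    closed i j i⋖j i≤ j≤ with ≤-suc-view i≤
    ... | inj₂ refl = natural-end⇒closed {w = w′} i⋖j 3≤3+K (inj₁ (extend₃-3 K w))
    ... | inj₁ i≤2+K with ≤-suc-view i≤2+K
    ...   | inj₂ refl with cover-adjacent i⋖j 3≤2+K
    ...     | inj₁ refl = natural-end⇒closed {w = w′} i⋖j 3≤2+K (inj₂ (extend₃-3 K w))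
    ...     | inj₂ refl = natural-end⇒closed {w = w′} i⋖j 3≤2+K (inj₂ (extend₃-1 K w))
    closed i j i⋖j i≤ j≤ | inj₁ i≤2+K | inj₁ i≤1+K with ≤-suc-view i≤1+K
    ... | inj₂ refl = natural-end⇒closed {w = w′} i⋖j 3≤1+K (inj₁ (extend₃-1 K w))
    ... | inj₁ i≤K with ≤-suc-view (cover-reach i⋖j i≤K 4≤K)
    ...   | inj₂ refl = natural-end⇒closed {w = w′} i⋖j (lower-from-tail i⋖j 5≤1+K) (inj₂ (extend₃-1 K w))
    ...   | inj₁ j≤K = proj₁ old i j i⋖j i≤K j≤K
    rigid-at-3 : RigidAt (3 + K) w′ (3 + K)
    rigid-at-3 = beside-free-rigid {w = w′} 5≤3+K (inj₂ refl) (n≤1+n (2 + K)) (extend₃-2 K w) (extend₃-3 K w)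
    rigid-at-1 : RigidAt (3 + K) w′ (1 + K)
    rigid-at-1 = beside-free-rigid {w = w′} 5≤1+K (inj₁ refl) (m≤n⇒m≤1+n ≤-refl) (extend₃-2 K w) (extend₃-1 K w)
    O-rigid′ : O-rigidᴺ (3 + K) w′
    O-rigid′ x 1≤x x≤ e with ≤-suc-view x≤
    ... | inj₂ refl = proj₁ rigid-at-3 e
    ... | inj₁ x≤2+K with ≤-suc-view x≤2+K
    ...   | inj₂ refl = λ _ → O≢C (trans (sym e) (extend₃-2 K w))
    ...   | inj₁ x≤1+K with ≤-suc-view x≤1+K
    ...     | inj₂ refl = proj₁ rigid-at-1 e
    ...     | inj₁ x≤K = proj₁ (proj₂ old) x 1≤x x≤K e
    I-rigid′ : I-rigidᴺ (3 + K) w′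
    I-rigid′ x 1≤x x≤ e with ≤-suc-view x≤
    ... | inj₂ refl = proj₂ rigid-at-3 e
    ... | inj₁ x≤2+K with ≤-suc-view x≤2+K
    ...   | inj₂ refl = λ _ → I≢C (trans (sym e) (extend₃-2 K w))
    ...   | inj₁ x≤1+K with ≤-suc-view x≤1+K
    ...     | inj₂ refl = proj₂ rigid-at-1 e
    ...     | inj₁ x≤K = proj₂ (proj₂ old) x 1≤x x≤K e

top-natural : ∀ {N w} → 5 ≤ N → Maximalᴺ N w → w N ≢ C → w N ≡ natural N
top-natural {N} {w} 5≤N (closed , O-rigid′ , I-rigid′) N-not-free with even N in e | w N in eN
... | _ | C = ⊥-elim (N-not-free refl)
... | true | I = refl
... | false | O = refl
... | true | O = ⊥-elim (O-rigid′ N 1≤N ≤-refl eN (upper-vacuous e (≤-trans (n≤1+n 3) (≤-trans (n≤1+n 4) 5≤N)) , down))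
  where
  1≤N = ≤-trans (s≤s z≤n) 5≤N
  down : LowerO N w N
  down i i⋖N i≤N with lower-cover-of-top i⋖N 5≤N i≤N
  ... | refl = [ (λ i-O → i-O) , (λ N-I → ⊥-elim (O≢I (trans (sym eN) N-I))) ]′ (closed i N i⋖N i≤N ≤-refl)
... | false | I = ⊥-elim (I-rigid′ N (≤-trans (s≤s z≤n) 5≤N) ≤-refl eN (lower-vacuous e 5≤N))

below-top-free : ∀ {M w} → 5 ≤ M → Maximalᴺ (ℕ.suc M) w → w (ℕ.suc M) ≡ natural (ℕ.suc M) → w M ≡ C
below-top-free {M} {w} 5≤M (closed , O-rigid′ , I-rigid′) top-natural′ with w M in eM | even (ℕ.suc M) in e
... | C | _ = refl
... | I | false = ⊥-elim (O-rigid′ (ℕ.suc M) (s≤s z≤n) ≤-refl top-natural′ (up , lower-vacuous e (m≤n⇒m≤1+n 5≤M)))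
  where
  up : UpperI (ℕ.suc M) w (ℕ.suc M)
  up j 1+M⋖j j≤ with upper-cover-of-top 1+M⋖j (s≤s (≤-trans (n≤1+n 2) (≤-trans (n≤1+n 3) (≤-trans (n≤1+n 4) 5≤M)))) j≤
  ... | refl = eM
... | O | false = ⊥-elim (O-rigid′ M 1≤M (n≤1+n M) eM (upper-vacuous M-even 3≤M , down))
  where
  1≤M = ≤-trans (s≤s z≤n) 5≤M
  3≤M = ≤-trans (n≤1+n 3) (≤-trans (n≤1+n 4) 5≤M)
  M-even : even M ≡ true
  M-even = trans (sym (not-involutive (even M))) (cong not e)
  down : LowerO (ℕ.suc M) w M
  down i i⋖M i≤ with cover-adjacent i⋖M (lower-from-tail i⋖M 5≤M)
  ... | inj₂ refl = top-natural′
  ... | inj₁ refl = [ (λ i-O → i-O) , (λ M-I → ⊥-elim (O≢I (trans (sym eM) M-I))) ]′ (closed i M i⋖M i≤ (n≤1+n M))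
... | O | true = ⊥-elim (I-rigid′ (ℕ.suc M) (s≤s z≤n) ≤-refl top-natural′ down)
  where
  down : LowerO (ℕ.suc M) w (ℕ.suc M)
  down i i⋖ i≤ with lower-cover-of-top i⋖ (m≤n⇒m≤1+n 5≤M) i≤
  ... | refl = eM
... | I | true = ⊥-elim (I-rigid′ M (≤-trans (s≤s z≤n) 5≤M) (n≤1+n M) eM (lower-vacuous M-odd 5≤M))
  where
  M-odd : even M ≡ false
  M-odd = trans (sym (not-involutive (even M))) (cong not e)

-- Reading a maximal labelling from the top: either x_N is free and x_(N-1) natural, or x_N is natural,
-- x_(N-1) free and x_(N-2) natural.
decompose : ∀ {K w} → 4 ≤ K → Maximalᴺ (3 + K) w →
  (Maximalᴺ (1 + K) w × Agree (3 + K) w (extend₂ (1 + K) w)) ⊎ (Maximalᴺ K w × Agree (3 + K) w (extend₃ K w))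
decompose {K} {w} 4≤K maximal@(closed , _) with w (3 + K) ≟ᴸ C
... | yes top-free = inj₁ (restrict (m≤n⇒m≤1+n 4≤K) (n≤1+n _) at-2 maximal , agree)
  where
  at-2 : w (2 + K) ≡ natural (2 + K)
  at-2 = beside-free⇒natural closed (n≤1+n _) ≤-refl (s≤s (m≤n⇒m≤1+n 4≤K)) (inj₁ refl) top-free
  agree : Agree (3 + K) w (extend₂ (1 + K) w)
  agree x _ x≤ with ≤-suc-view x≤
  ... | inj₂ refl = trans top-free (sym (extend₂-2 (1 + K) w))
  ... | inj₁ x≤2+K with ≤-suc-view x≤2+K
  ...   | inj₂ refl = trans at-2 (sym (extend₂-1 (1 + K) w))
  ...   | inj₁ x≤1+K = sym (extend₂-below (1 + K) w x≤1+K)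
... | no top-not-free = inj₂ (restrict 4≤K (m≤n⇒m≤1+n (n≤1+n _)) at-1 maximal , agree)
  where
  at-3 : w (3 + K) ≡ natural (3 + K)
  at-3 = top-natural (m≤n⇒m≤1+n (m≤n⇒m≤1+n (s≤s 4≤K))) maximal top-not-free
  at-2 : w (2 + K) ≡ C
  at-2 = below-top-free (m≤n⇒m≤1+n (s≤s 4≤K)) maximal at-3
  at-1 : w (1 + K) ≡ natural (1 + K)
  at-1 = beside-free⇒natural closed (m≤n⇒m≤1+n (n≤1+n _)) (n≤1+n _) (s≤s 4≤K) (inj₁ refl) at-2
  agree : Agree (3 + K) w (extend₃ K w)
  agree x _ x≤ with ≤-suc-view x≤
  ... | inj₂ refl = trans at-3 (sym (extend₃-3 K w))
  ... | inj₁ x≤2+K with ≤-suc-view x≤2+K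
  ...   | inj₂ refl = trans at-2 (sym (extend₃-2 K w))
  ...   | inj₁ x≤1+K with ≤-suc-view x≤1+K
  ...     | inj₂ refl = trans at-1 (sym (extend₃-1 K w))
  ...     | inj₁ x≤K = sym (extend₃-below K w x≤K)

-- Deciding maximality of labellings of φ_N for N ≤ 7

coverᵇ : ℕ → ℕ → Bool
coverᵇ 2 1 = true
coverᵇ 3 2 = true
coverᵇ 2 4 = true
coverᵇ 5 4 = true
coverᵇ 5 6 = true
coverᵇ 7 6 = true
coverᵇ _ _ = false

coverᵇ-sound : ∀ i j → coverᵇ i j ≡ true → CoverIdx i j
coverᵇ-sound 2 1 _ = c21
coverᵇ-sound 3 2 _ = c32
coverᵇ-sound 2 4 _ = c24
coverᵇ-sound 5 4 _ = c54
coverᵇ-sound 5 6 _ = cOdd 0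
coverᵇ-sound 7 6 _ = cOdd' 0

2*suc+6≰7 : ∀ m → ¬ (2 * ℕ.suc m + 6 ≤ 7)
2*suc+6≰7 m le with ≤-trans (m≤n+m 6 (2 * m)) (ℕ.s≤s⁻¹ (ℕ.s≤s⁻¹ (≤-trans (≤-reflexive (sym (2*suc+ m 6))) le)))
... | s≤s (s≤s (s≤s (s≤s (s≤s ()))))

coverᵇ-complete : ∀ {i j} → CoverIdx i j → j ≤ 7 → coverᵇ i j ≡ true
coverᵇ-complete c21 _ = refl
coverᵇ-complete c32 _ = refl
coverᵇ-complete c24 _ = refl
coverᵇ-complete c54 _ = refl
coverᵇ-complete (cOdd 0) _ = refl
coverᵇ-complete (cOdd' 0) _ = refl
coverᵇ-complete (cOdd (ℕ.suc m)) j≤7 = ⊥-elim (2*suc+6≰7 m j≤7)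
coverᵇ-complete (cOdd' (ℕ.suc m)) j≤7 = ⊥-elim (2*suc+6≰7 m j≤7)

CoverIdx? : ∀ i j → j ≤ 7 → Dec (CoverIdx i j)
CoverIdx? i j j≤7 = map′ (coverᵇ-sound i j) (λ i⋖j → coverᵇ-complete i⋖j j≤7) (coverᵇ i j ≟ᵇ true)

∀[1,_]? : ∀ N {P : ℕ → Set} → (∀ x → x ≤ N → Dec (P x)) → Dec (∀ x → 1 ≤ x → x ≤ N → P x)
∀[1, ℕ.zero ]? P? = yes λ { x 1≤x x≤0 → ⊥-elim (1+n≰n (≤-trans 1≤x x≤0)) }
∀[1, ℕ.suc N ]? P? with P? (ℕ.suc N) ≤-refl | ∀[1, N ]? (λ x x≤N → P? x (m≤n⇒m≤1+n x≤N))
... | no ¬top | _ = no λ all → ¬top (all (ℕ.suc N) (s≤s z≤n) ≤-refl)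
... | yes _ | no ¬below = no λ all → ¬below λ x 1≤x x≤N → all x 1≤x (m≤n⇒m≤1+n x≤N)
... | yes top | yes below = yes λ x 1≤x x≤ → [ below x 1≤x , (λ { refl → top }) ]′ (≤-suc-view x≤)

module _ {N : ℕ} (N≤7 : N ≤ 7) (w : ℕ → Label) where

  UpperI? : ∀ x → Dec (UpperI N w x)
  UpperI? x = map′ (λ h j x⋖j j≤N → h j (proj₂ (cover-positive x⋖j)) j≤N x⋖j) (λ h j _ j≤N x⋖j → h j x⋖j j≤N)
    (∀[1, N ]? λ j j≤N → CoverIdx? x j (≤-trans j≤N N≤7) →-dec (w j ≟ᴸ I))

  LowerO? : ∀ x → x ≤ N → Dec (LowerO N w x)
  LowerO? x x≤N = map′ (λ h i i⋖x i≤N → h i (proj₁ (cover-positive i⋖x)) i≤N i⋖x) (λ h i _ i≤N i⋖x → h i i⋖x i≤N)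
    (∀[1, N ]? λ i _ → CoverIdx? i x (≤-trans x≤N N≤7) →-dec (w i ≟ᴸ O))

  Maximalᴺ? : Dec (Maximalᴺ N w)
  Maximalᴺ? = closed? ×-dec (O-rigid? ×-dec I-rigid?)
    where
    closed? : Dec (Closedᴺ N w)
    closed? = map′ (λ h i j i⋖j i≤N j≤N → h i (proj₁ (cover-positive i⋖j)) i≤N j (proj₂ (cover-positive i⋖j)) j≤N i⋖j)
                   (λ h i _ i≤N j _ j≤N i⋖j → h i j i⋖j i≤N j≤N)
      (∀[1, N ]? λ i _ → ∀[1, N ]? λ j j≤N → CoverIdx? i j (≤-trans j≤N N≤7) →-dec ((w i ≟ᴸ O) ⊎-dec (w j ≟ᴸ I)))
    O-rigid? : Dec (O-rigidᴺ N w)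
    O-rigid? = ∀[1, N ]? λ x x≤N → (w x ≟ᴸ O) →-dec ¬? (UpperI? x ×-dec LowerO? x x≤N)
    I-rigid? : Dec (I-rigidᴺ N w)
    I-rigid? = ∀[1, N ]? λ x x≤N → (w x ≟ᴸ I) →-dec ¬? (LowerO? x x≤N)

Agree? : ∀ N w w′ → Dec (Agree N w w′)
Agree? N w w′ = ∀[1, N ]? λ x _ → w x ≟ᴸ w′ x

-- Positions outside 1, …, N read the junk value O.
fromVec : ∀ {N} → Vec Label N → ℕ → Label
fromVec [] _ = O
fromVec (_ ∷ _) ℕ.zero = O
fromVec (l ∷ _) 1 = l
fromVec (_ ∷ v) (ℕ.suc (ℕ.suc x)) = fromVec v (ℕ.suc x)

toVec : ∀ N → (ℕ → Label) → Vec Label N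
toVec ℕ.zero w = []
toVec (ℕ.suc N) w = w 1 ∷ toVec N (w ∘ ℕ.suc)

fromVec-toVec : ∀ N w → Agree N (fromVec (toVec N w)) w
fromVec-toVec (ℕ.suc N) w 1 _ _ = refl
fromVec-toVec (ℕ.suc N) w (ℕ.suc (ℕ.suc x)) _ (s≤s x≤N) = fromVec-toVec N (w ∘ ℕ.suc) (ℕ.suc x) (s≤s z≤n) x≤N

∀-Label? : ∀ {P : Label → Set} → (∀ l → Dec (P l)) → Dec (∀ l → P l)
∀-Label? P? = map′ (λ { (pO , pI , pC) → λ { O → pO ; I → pI ; C → pC } }) (λ h → h O , h I , h C)
  (P? O ×-dec (P? I ×-dec P? C))

∀-Vec? : ∀ N {P : Vec Label N → Set} → (∀ v → Dec (P v)) → Dec (∀ v → P v)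
∀-Vec? ℕ.zero P? = map′ (λ { p [] → p }) (λ h → h []) (P? [])
∀-Vec? (ℕ.suc N) P? = map′ (λ { h (l ∷ v) → h v l }) (λ h v l → h (l ∷ v)) (∀-Vec? N λ v → ∀-Label? λ l → P? (l ∷ v))

record Enumerates (N c : ℕ) (E : Fin c → ℕ → Label) : Set where
  field
    maximal : ∀ i → Maximalᴺ N (E i)
    injective : ∀ i j → Agree N (E i) (E j) → i ≡ j
    complete : ∀ w → Maximalᴺ N w → ∃[ i ] Agree N w (E i)

Enumerates? : ∀ {N c} → N ≤ 7 → (table : Vec (Vec Label N) c) → Dec (Enumerates N c (fromVec ∘ lookup table))
Enumerates? {N} {c} N≤7 table =
  map′ from to
    (all? (λ i → Maximalᴺ? N≤7 (E i))
      ×-dec (all? λ i → all? λ j → Agree? N (E i) (E j) →-dec (i ≟ j))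
      ×-dec ∀-Vec? N λ v → Maximalᴺ? N≤7 (fromVec v) →-dec any? λ i → Agree? N (fromVec v) (E i))
  where
  E : Fin c → ℕ → Label
  E = fromVec ∘ lookup table
  Finite : Set
  Finite = (∀ i → Maximalᴺ N (E i)) × (∀ i j → Agree N (E i) (E j) → i ≡ j)
         × (∀ v → Maximalᴺ N (fromVec v) → ∃[ i ] Agree N (fromVec v) (E i))
  from : Finite → Enumerates N c E
  from (maximal , injective , complete) = record { maximal = maximal ; injective = injective ; complete = complete′ }
    where
    complete′ : ∀ w → Maximalᴺ N w → ∃[ i ] Agree N w (E i)
    complete′ w w-max with complete (toVec N w) (Maximalᴺ-cong (λ x 1≤x x≤N → sym (fromVec-toVec N w x 1≤x x≤N)) w-max)
    ... | i , agree = i , Agree-trans (λ x 1≤x x≤N → sym (fromVec-toVec N w x 1≤x x≤N)) agree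
  to : Enumerates N c E → Finite
  to e = maximal , injective , λ v → complete (fromVec v)
    where open Enumerates e

table₃ : Vec (Vec Label 3) 3
table₃ = (I ∷ I ∷ C ∷ []) ∷ (I ∷ C ∷ O ∷ []) ∷ (C ∷ O ∷ O ∷ []) ∷ []

table₄ : Vec (Vec Label 4) 3
table₄ = (I ∷ I ∷ C ∷ I ∷ []) ∷ (I ∷ C ∷ O ∷ I ∷ []) ∷ (C ∷ O ∷ O ∷ C ∷ []) ∷ []

table₅ : Vec (Vec Label 5) 4
table₅ = (I ∷ I ∷ C ∷ I ∷ C ∷ []) ∷ (I ∷ C ∷ O ∷ I ∷ C ∷ []) ∷ (C ∷ O ∷ O ∷ I ∷ C ∷ []) ∷ (C ∷ O ∷ O ∷ C ∷ O ∷ []) ∷ []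

table₆ : Vec (Vec Label 6) 6
table₆ = (I ∷ I ∷ C ∷ I ∷ O ∷ C ∷ []) ∷ (I ∷ I ∷ C ∷ I ∷ C ∷ I ∷ []) ∷ (I ∷ C ∷ O ∷ I ∷ O ∷ C ∷ [])
       ∷ (I ∷ C ∷ O ∷ I ∷ C ∷ I ∷ []) ∷ (C ∷ O ∷ O ∷ I ∷ C ∷ I ∷ []) ∷ (C ∷ O ∷ O ∷ C ∷ O ∷ C ∷ []) ∷ []

table₇ : Vec (Vec Label 7) 7
table₇ = (I ∷ I ∷ C ∷ I ∷ O ∷ C ∷ O ∷ []) ∷ (I ∷ I ∷ C ∷ I ∷ C ∷ I ∷ C ∷ []) ∷ (I ∷ C ∷ O ∷ I ∷ O ∷ C ∷ O ∷ [])
       ∷ (I ∷ C ∷ O ∷ I ∷ C ∷ I ∷ C ∷ []) ∷ (C ∷ O ∷ O ∷ I ∷ C ∷ I ∷ C ∷ []) ∷ (C ∷ O ∷ O ∷ C ∷ O ∷ I ∷ C ∷ [])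
       ∷ (C ∷ O ∷ O ∷ C ∷ O ∷ C ∷ O ∷ []) ∷ []

module _ (K : ℕ) {w w′ : ℕ → Label} where

  extend₂-cong : Agree K w w′ → Agree (2 + K) (extend₂ K w) (extend₂ K w′)
  extend₂-cong w≈w′ x 1≤x x≤ with ≤-suc-view x≤
  ... | inj₂ refl = trans (extend₂-2 K w) (sym (extend₂-2 K w′))
  ... | inj₁ x≤1+K with ≤-suc-view x≤1+K
  ...   | inj₂ refl = trans (extend₂-1 K w) (sym (extend₂-1 K w′))
  ...   | inj₁ x≤K = trans (extend₂-below K w x≤K) (trans (w≈w′ x 1≤x x≤K) (sym (extend₂-below K w′ x≤K)))

  extend₃-cong : Agree K w w′ → Agree (3 + K) (extend₃ K w) (extend₃ K w′)
  extend₃-cong w≈w′ x 1≤x x≤ with ≤-suc-view x≤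
  ... | inj₂ refl = trans (extend₃-3 K w) (sym (extend₃-3 K w′))
  ... | inj₁ x≤2+K with ≤-suc-view x≤2+K
  ...   | inj₂ refl = trans (extend₃-2 K w) (sym (extend₃-2 K w′))
  ...   | inj₁ x≤1+K with ≤-suc-view x≤1+K
  ...     | inj₂ refl = trans (extend₃-1 K w) (sym (extend₃-1 K w′))
  ...     | inj₁ x≤K = trans (extend₃-below K w x≤K) (trans (w≈w′ x 1≤x x≤K) (sym (extend₃-below K w′ x≤K)))

  extend₂-cancel : Agree (2 + K) (extend₂ K w) (extend₂ K w′) → Agree K w w′
  extend₂-cancel agree x 1≤x x≤K = trans (sym (extend₂-below K w x≤K))
    (trans (agree x 1≤x (m≤n⇒m≤1+n (m≤n⇒m≤1+n x≤K))) (extend₂-below K w′ x≤K))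

  extend₃-cancel : Agree (3 + K) (extend₃ K w) (extend₃ K w′) → Agree K w w′
  extend₃-cancel agree x 1≤x x≤K = trans (sym (extend₃-below K w x≤K))
    (trans (agree x 1≤x (m≤n⇒m≤1+n (m≤n⇒m≤1+n (m≤n⇒m≤1+n x≤K)))) (extend₃-below K w′ x≤K))

splitAt-injective : ∀ m {n} {i j : Fin (m + n)} → splitAt m i ≡ splitAt m j → i ≡ j
splitAt-injective m {n} {i} {j} e = trans (sym (join-splitAt m n i)) (trans (cong (join m n) e) (join-splitAt m n j))

combine : ∀ {c d} → ℕ → (Fin c → ℕ → Label) → (Fin d → ℕ → Label) → Fin (c + d) → ℕ → Label
combine {c} K E F i = [ extend₂ (1 + K) ∘ E , extend₃ K ∘ F ]′ (splitAt c i)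

Enumerates-combine : ∀ {K c d E F} → 4 ≤ K → Enumerates (1 + K) c E → Enumerates K d F → Enumerates (3 + K) (c + d) (combine K E F)
Enumerates-combine {K} {c} {d} {E} {F} 4≤K enum-E enum-F = record { maximal = maximal ; injective = injective ; complete = complete }
  where
  module E = Enumerates enum-E
  module F = Enumerates enum-F
  maximal : ∀ i → Maximalᴺ (3 + K) (combine K E F i)
  maximal i with splitAt c i
  ... | inj₁ a = extend₂-maximal (m≤n⇒m≤1+n 4≤K) (E.maximal a)
  ... | inj₂ b = extend₃-maximal 4≤K (F.maximal b)
  different-tops : ∀ a b → ¬ Agree (3 + K) (extend₂ (1 + K) (E a)) (extend₃ K (F b))
  different-tops a b agree = natural≢C (3 + K) (trans (sym (extend₃-3 K (F b))) (trans (sym (agree (3 + K) (s≤s z≤n) ≤-refl)) (extend₂-2 (1 + K) (E a))))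
  injective : ∀ i j → Agree (3 + K) (combine K E F i) (combine K E F j) → i ≡ j
  injective i j agree with splitAt c i in eᵢ | splitAt c j in eⱼ
  ... | inj₁ a | inj₁ b = splitAt-injective c (trans eᵢ (trans (cong inj₁ (E.injective a b (extend₂-cancel (1 + K) agree))) (sym eⱼ)))
  ... | inj₂ a | inj₂ b = splitAt-injective c (trans eᵢ (trans (cong inj₂ (F.injective a b (extend₃-cancel K agree))) (sym eⱼ)))
  ... | inj₁ a | inj₂ b = ⊥-elim (different-tops a b agree)
  ... | inj₂ a | inj₁ b = ⊥-elim (different-tops b a (λ x 1≤x x≤ → sym (agree x 1≤x x≤)))
  complete : ∀ w → Maximalᴺ (3 + K) w → ∃[ i ] Agree (3 + K) w (combine K E F i)
  complete w w-max with decompose 4≤K w-max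
  ... | inj₁ (max₂ , w≈) = let (a , agree) = E.complete w max₂ in
    a ↑ˡ d , subst (Agree (3 + K) w) (sym (cong [ extend₂ (1 + K) ∘ E , extend₃ K ∘ F ]′ (splitAt-↑ˡ c a d)))
                   (Agree-trans w≈ (extend₂-cong (1 + K) agree))
  ... | inj₂ (max₃ , w≈) = let (b , agree) = F.complete w max₃ in
    c ↑ʳ b , subst (Agree (3 + K) w) (sym (cong [ extend₂ (1 + K) ∘ E , extend₃ K ∘ F ]′ (splitAt-↑ʳ c d b)))
                   (Agree-trans w≈ (extend₃-cong K agree))

enumerate : (n : ℕ) → Fin (p (n ∸ 2)) → ℕ → Label
enumerate 0 = λ _ _ → O
enumerate 1 = λ _ _ → O
enumerate 2 = λ _ _ → O
enumerate 3 = fromVec ∘ lookup table₃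
enumerate 4 = fromVec ∘ lookup table₄
enumerate 5 = fromVec ∘ lookup table₅
enumerate 6 = fromVec ∘ lookup table₆
enumerate 7 = fromVec ∘ lookup table₇
enumerate (ℕ.suc (ℕ.suc (ℕ.suc (ℕ.suc (ℕ.suc (ℕ.suc (ℕ.suc (ℕ.suc m)))))))) =
  combine (5 + m) (enumerate (ℕ.suc (ℕ.suc (ℕ.suc (ℕ.suc (ℕ.suc (ℕ.suc m))))))) (enumerate (ℕ.suc (ℕ.suc (ℕ.suc (ℕ.suc (ℕ.suc m))))))

Enumerates-enumerate : ∀ n → 3 ≤ n → Enumerates n (p (n ∸ 2)) (enumerate n)
Enumerates-enumerate 1 (s≤s ())
Enumerates-enumerate 2 (s≤s (s≤s ()))
Enumerates-enumerate 3 _ = from-yes (Enumerates? (from-yes (3 ℕ.≤? 7)) table₃)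
Enumerates-enumerate 4 _ = from-yes (Enumerates? (from-yes (4 ℕ.≤? 7)) table₄)
Enumerates-enumerate 5 _ = from-yes (Enumerates? (from-yes (5 ℕ.≤? 7)) table₅)
Enumerates-enumerate 6 _ = from-yes (Enumerates? (from-yes (6 ℕ.≤? 7)) table₆)
Enumerates-enumerate 7 _ = from-yes (Enumerates? (from-yes (7 ℕ.≤? 7)) table₇)
Enumerates-enumerate (ℕ.suc (ℕ.suc (ℕ.suc (ℕ.suc (ℕ.suc (ℕ.suc (ℕ.suc (ℕ.suc m)))))))) _ =
  Enumerates-combine (s≤s (s≤s (s≤s (s≤s z≤n))))
    (Enumerates-enumerate (ℕ.suc (ℕ.suc (ℕ.suc (ℕ.suc (ℕ.suc (ℕ.suc m)))))) (s≤s (s≤s (s≤s z≤n))))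
    (Enumerates-enumerate (ℕ.suc (ℕ.suc (ℕ.suc (ℕ.suc (ℕ.suc m))))) (s≤s (s≤s (s≤s z≤n))))

atFin : (n : ℕ) → (ℕ → Label) → Fin n → Label
atFin n w a = w (ℕ.suc (toℕ a))

fin-of : ∀ {n} x → 1 ≤ x → x ≤ n → Σ[ a ∈ Fin n ] ℕ.suc (toℕ a) ≡ x
fin-of (ℕ.suc x) _ x<n = fromℕ< x<n , cong ℕ.suc (toℕ-fromℕ< x<n)

Maximalᴺ⇒IsMaximalLabelling : ∀ {n w} → Maximalᴺ n w → IsMaximalLabelling (atFin n w)
Maximalᴺ⇒IsMaximalLabelling {n} {w} (closed , O-rigid′ , I-rigid′) = closed′ , O-rigid″ , I-rigid″
  where
  up : ∀ x → (∀ y → Cover n x y → atFin n w y ≡ I) → UpperI n w (ℕ.suc (toℕ x))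
  up x up′ j x⋖j j≤n with fin-of j (proj₂ (cover-positive x⋖j)) j≤n
  ... | y , refl = up′ y x⋖j
  down : ∀ x → (∀ y → Cover n y x → atFin n w y ≡ O) → LowerO n w (ℕ.suc (toℕ x))
  down x down′ i i⋖x i≤n with fin-of i (proj₁ (cover-positive i⋖x)) i≤n
  ... | y , refl = down′ y i⋖x
  closed′ : Closed (atFin n w)
  closed′ x y x⋖y = closed _ _ x⋖y (toℕ<n x) (toℕ<n y)
  O-rigid″ : O-rigid (atFin n w)
  O-rigid″ x e (up′ , down′) = O-rigid′ _ (s≤s z≤n) (toℕ<n x) e (up x up′ , down x down′)
  I-rigid″ : I-rigid (atFin n w)
  I-rigid″ x e down′ = I-rigid′ _ (s≤s z≤n) (toℕ<n x) e (down x down′)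

IsMaximalLabelling⇒Maximalᴺ : ∀ {n w} → IsMaximalLabelling (atFin n w) → Maximalᴺ n w
IsMaximalLabelling⇒Maximalᴺ {n} {w} (closed , O-rigid′ , I-rigid′) = closed′ , O-rigid″ , I-rigid″
  where
  closed′ : Closedᴺ n w
  closed′ i j i⋖j i≤n j≤n with fin-of i (proj₁ (cover-positive i⋖j)) i≤n | fin-of j (proj₂ (cover-positive i⋖j)) j≤n
  ... | x , refl | y , refl = closed x y i⋖j
  O-rigid″ : O-rigidᴺ n w
  O-rigid″ i 1≤i i≤n e (up , down) with fin-of i 1≤i i≤n
  ... | x , refl = O-rigid′ x e ((λ y x⋖y → up _ x⋖y (toℕ<n y)) , (λ y y⋖x → down _ y⋖x (toℕ<n y)))
  I-rigid″ : I-rigidᴺ n w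
  I-rigid″ i 1≤i i≤n e down with fin-of i 1≤i i≤n
  ... | x , refl = I-rigid′ x e (λ y y⋖x → down _ y⋖x (toℕ<n y))

IsMaximalLabelling-cong : ∀ {n} {lab lab′ : Fin n → Label} → (∀ a → lab a ≡ lab′ a) → IsMaximalLabelling lab → IsMaximalLabelling lab′
IsMaximalLabelling-cong {lab = lab} {lab′} lab≗lab′ (closed , O-rigid′ , I-rigid′) = closed′ , O-rigid″ , I-rigid″
  where
  closed′ : Closed lab′
  closed′ x y x⋖y = Sum.map (trans (sym (lab≗lab′ x))) (trans (sym (lab≗lab′ y))) (closed x y x⋖y)
  O-rigid″ : O-rigid lab′
  O-rigid″ x e (up , down) = O-rigid′ x (trans (lab≗lab′ x) e)
    ((λ y x⋖y → trans (lab≗lab′ y) (up y x⋖y)) , (λ y y⋖x → trans (lab≗lab′ y) (down y y⋖x)))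
  I-rigid″ : I-rigid lab′
  I-rigid″ x e down = I-rigid′ x (trans (lab≗lab′ x) e) (λ y y⋖x → trans (lab≗lab′ y) (down y y⋖x))

Agree⇒atFin : ∀ {n w w′} → Agree n w w′ → ∀ a → atFin n w a ≡ atFin n w′ a
Agree⇒atFin w≈w′ a = w≈w′ _ (s≤s z≤n) (toℕ<n a)

atFin⇒Agree : ∀ {n w w′} → (∀ a → atFin n w a ≡ atFin n w′ a) → Agree n w w′
atFin⇒Agree same x 1≤x x≤n with fin-of x 1≤x x≤n
... | a , refl = same a

atFin-fromVec : ∀ {n} (v : Vec Label n) a → atFin n (fromVec v) a ≡ lookup v a
atFin-fromVec (l ∷ _) zero = refl
atFin-fromVec (_ ∷ v) (suc a) = atFin-fromVec v a

Enumerates⇒HOneEq : ∀ {n c E} → Enumerates n c E → HOneEq n c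
Enumerates⇒HOneEq {n} {c} {E} enum = vertices ∘ atFin n ∘ E , maximal′ , injective′ , complete′
  where
  open Enumerates enum
  maximal′ : ∀ i → IsMaximalCube n (vertices (atFin n (E i)))
  maximal′ i = labelling⇒maximal-cube (Maximalᴺ⇒IsMaximalLabelling (maximal i))
  injective′ : ∀ i j → vertices (atFin n (E i)) ≐ vertices (atFin n (E j)) → i ≡ j
  injective′ i j same = injective i j (atFin⇒Agree (vertices-injective {lab = atFin n (E i)} {atFin n (E j)} same))
  complete′ : ∀ S → IsMaximalCube n S → ∃[ i ] S ≐ vertices (atFin n (E i))
  complete′ S S-max = i , λ U → trans (S≐ U) (vertices-cong {lab = lab} {atFin n (E i)} lab≗ U)
    where
    lab : Fin n → Label
    lab = proj₁ (maximal-cube⇒labelling S-max)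
    S≐ : S ≐ vertices lab
    S≐ = proj₂ (proj₂ (maximal-cube⇒labelling S-max))
    w : ℕ → Label
    w = fromVec (tabulate lab)
    w≗lab : ∀ a → atFin n w a ≡ lab a
    w≗lab a = trans (atFin-fromVec (tabulate lab) a) (lookup∘tabulate lab a)
    found : ∃[ i ] Agree n w (E i)
    found = complete w (IsMaximalLabelling⇒Maximalᴺ (IsMaximalLabelling-cong (sym ∘ w≗lab) (proj₁ (proj₂ (maximal-cube⇒labelling S-max)))))
    i : Fin c
    i = proj₁ found
    lab≗ : ∀ a → lab a ≡ atFin n (E i) a
    lab≗ a = trans (sym (w≗lab a)) (Agree⇒atFin (proj₂ found) a)

corollary4 : ∀ (n : ℕ) → 3 ≤ n → HOneEq n (p (n ∸ 2))
corollary4 n 3≤n = Enumerates⇒HOneEq (Enumerates-enumerate n 3≤n)
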